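{- Let $\alpha\in\mathfrak S_a$ and $\beta\in\mathfrak S_b$ be permutations and let $\pi=12[\alpha,\beta]$. Then (i) $\operatorname{diam}(G_{\pi})=\operatorname{diam}(G_{\alpha})+\operatorname{diam}(G_{\beta})+\ell(\alpha)\ell(\beta)$; (ii) $\operatorname{diam}(C_{\pi})=\operatorname{diam}(C_{\alpha})+\operatorname{diam}(C_{\beta})$; (iii) $\operatorname{diam}(B_{\pi})=\operatorname{diam}(B_{\alpha})+\operatorname{diam}(B_{\beta})+\ell(\alpha)\ell(\beta)$.
   Context: For $\pi\in\mathfrak S_n$, $s_i=(i,i+1)$ denotes the adjacent transposition, $\ell(\pi)$ is the length of $\pi$ (its number of inversions), and $R(\pi)$ is the set of reduced words of $\pi$, i.e. words $r_1r_2\cdots r_{\ell(\pi)}$ with letters in $[n-1]$ such that $\pi=s_{r_1}s_{r_2}\cdots s_{r_{\ell(\pi)}}$. A commutation move exchanges two adjacent letters $jk$ with $|j-k|>1$; a long braid move replaces three consecutive letters $j(j+1)j$ by $(j+1)j(j+1)$ or vice versa. $G_\pi$ is the graph on vertex set $R(\pi)$ whose edges join words related by a single commutation move (commutation edges) or a single long braid move (long braid edges). $C_\pi$ is obtained from $G_\pi$ by contracting all commutation edges (vertices are commutation classes; two classes are adjacent if some members are related by a long braid move), and $B_\pi$ is obtained from $G_\pi$ by contracting all long braid edges (vertices are braid classes; adjacency via a commutation move). The diameter $\operatorname{diam}$ of a connected graph is the maximum distance between two vertices (a one-vertex graph has diameter $0$). For $\alpha=\alpha_1\cdots\alpha_a\in\mathfrak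 S_a$ and $\beta=\beta_1\cdots\beta_b\in\mathfrak S_b$ (sizes may be $0$), the inflation $12[\alpha,\beta]$ is the permutation $\alpha_1\cdots\alpha_a(\beta_1+a)\cdots(\beta_b+a)\in\mathfrak S_{a+b}$ in one-line notation. -}

module Defs where

open import Data.Nat using (ℕ; zero; suc; _+_; _*_; _∸_; _≤_; _<_; _<ᵇ_; _≡ᵇ_)
open import Data.Bool using (Bool; true; false; if_then_else_; _∧_)
open import Data.Fin using (Fin; toℕ; splitAt; _↑ˡ_; _↑ʳ_)
open import Data.Sum using (_⊎_; inj₁; inj₂)
open import Data.Product using (Σ; _×_; _,_; ∃; ∃-syntax)
open import Data.List using (List; []; _∷_; _++_; length; allFin; cartesianProduct; filterᵇ)
open import Data.List.Relation.Unary.All using (All)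
open import Relation.Binary.PropositionalEquality using (_≡_)
open import Relation.Binary.Construct.Closure.ReflexiveTransitive using (Star)

-- Permutations of [n] are handled through their underlying functions
-- Fin n → Fin n (one-line notation: position i ↦ value f i, 0-indexed).

inflate : ∀ {a b} → (Fin a → Fin a) → (Fin b → Fin b) → Fin (a + b) → Fin (a + b)
inflate {a} {b} α β i with splitAt a i
... | inj₁ j = α j ↑ˡ b
... | inj₂ j = a ↑ʳ β j

len : ∀ {n} → (Fin n → Fin n) → ℕ
len {n} f = length (filterᵇ isInv (cartesianProduct (allFin n) (allFin n)))
  where
  isInv : Fin n × Fin n → Bool
  isInv (i , j) = (toℕ i <ᵇ toℕ j) ∧ (toℕ (f j) <ᵇ toℕ (f i))

-- Words. A word is a list of letters (natural numbers); letter r stands for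
-- the adjacent transposition s_r = (r, r+1) of positions 1..n, i.e. it swaps
-- the 0-indexed points r ∸ 1 and r.

Word : Set
Word = List ℕ

s : ℕ → ℕ → ℕ
s r m = if m ≡ᵇ (r ∸ 1) then r else (if m ≡ᵇ r then r ∸ 1 else m)

evalW : Word → ℕ → ℕ
evalW []      m = m
evalW (r ∷ w) m = s r (evalW w m)

Letter : ℕ → ℕ → Set
Letter n r = 1 ≤ r × r < n

Reduced : ∀ {n} → (Fin n → Fin n) → Word → Set
Reduced {n} f w =
  All (Letter n) w × length w ≡ len f × (∀ i → evalW w (toℕ i) ≡ toℕ (f i))

FarApart : ℕ → ℕ → Set
FarApart j k = suc j < k ⊎ suc k < j

CommMove : Word → Word → Set
CommMove w w' = ∃[ u ] ∃[ v ] ∃[ j ] ∃[ k ]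
  (FarApart j k × w ≡ u ++ j ∷ k ∷ v × w' ≡ u ++ k ∷ j ∷ v)

BraidMove : Word → Word → Set
BraidMove w w' = ∃[ u ] ∃[ v ] ∃[ j ]
  ((w ≡ u ++ j ∷ suc j ∷ j ∷ v × w' ≡ u ++ suc j ∷ j ∷ suc j ∷ v)
   ⊎ (w ≡ u ++ suc j ∷ j ∷ suc j ∷ v × w' ≡ u ++ j ∷ suc j ∷ j ∷ v))

-- Graphs whose vertices may be classes of an equivalence ("setoid graphs").
-- Vertices are represented by elements x of A with V x; two representatives
-- denote the same vertex iff Same x y; Adj is the adjacency of vertices.

record SGraph (A : Set) : Set₁ where
  field
    V    : A → Set
    Same : A → A → Set
    Adj  : A → A → Set
open SGraph public

data Walk {A : Set} (G : SGraph A) : ℕ → A → A → Set where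
  here : ∀ {x y} → Same G x y → Walk G 0 x y
  step : ∀ {k x z y} → Adj G x z → Walk G k z y → Walk G (suc k) x y

IsDiam : ∀ {A} → SGraph A → ℕ → Set
IsDiam G d =
  (∀ x y → V G x → V G y → ∃[ k ] (k ≤ d × Walk G k x y))
  × (∃[ x ] ∃[ y ] (V G x × V G y × (∀ k → Walk G k x y → d ≤ k)))

plain : ∀ {A} → (A → Set) → (A → A → Set) → SGraph A
plain V E = record { V = V ; Same = _≡_ ; Adj = E }

-- The graph on vertex set V with edge relations F and E, after contracting
-- all F-edges: vertices are the connected components of (V, F); two
-- components are adjacent iff some members are joined by an E-edge.
contract : ∀ {A} → (A → Set) → (F E : A → A → Set) → SGraph A
contract {A} V F E = record { V = V ; Same = Star FV ; Adj = adj }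
  where
  FV : A → A → Set
  FV x y = V x × V y × F x y
  adj : A → A → Set
  adj x y = ∃[ x' ] ∃[ y' ] (Star FV x x' × Star FV y y' × V x' × V y' × E x' y')

CommEdge BraidEdge : ∀ {n} → (Fin n → Fin n) → Word → Word → Set
CommEdge  f w w' = Reduced f w × Reduced f w' × CommMove w w'
BraidEdge f w w' = Reduced f w × Reduced f w' × BraidMove w w'

Gr : ∀ {n} → (Fin n → Fin n) → SGraph Word
Gr f = plain (Reduced f) (λ w w' → CommEdge f w w' ⊎ BraidEdge f w w')

Cgr : ∀ {n} → (Fin n → Fin n) → SGraph Word
Cgr f = contract (Reduced f) (CommEdge f) (BraidEdge f)

Bgr : ∀ {n} → (Fin n → Fin n) → SGraph Word
Bgr f = contract (Reduced f) (BraidEdge f) (CommEdge f)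

-- A reduced word of π = 12[α,β] never contains the letter a = |α|: along a reduced word every letter
-- creates an inversion and removes none, π has no inversion across the cut at a, and the letter a
-- applied to a permutation without such crossing inversions always creates one. Hence every reduced
-- word w of π is a shuffle of its low letters, a reduced word of α, and its high letters lowered by a,
-- a reduced word of β. A braid move of w, or a commutation of two letters on the same side, is a move
-- of the same kind in α or in β; a commutation of a low and a high letter changes only the number
-- highLow w of (high , low) pairs, by one. So a walk in G_π or B_π projects to walks for α and β whose
-- lengths plus the change of highLow are paid for by its length; from x ++ shift y (highLow 0) to
-- shift y' ++ x' (highLow ℓ(α)ℓ(β)) this is the lower bound. Conversely, sort both endpoints by
-- commutations into blocks, in whichever order is cheaper (the two costs of a word add up to
-- ℓ(α)ℓ(β)), and walk inside the blocks. In C_π commutations are free.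

module Submission where

open import Defs
open import Data.Nat
open import Data.Nat.Properties
open import Data.Bool using (Bool; true; false; if_then_else_; _∧_; T; not)
open import Data.Bool.Properties using (∧-zeroʳ)
open import Data.Sum using (_⊎_; inj₁; inj₂; [_,_]′)
open import Data.Product using (_×_; _,_; ∃; ∃-syntax; proj₁; proj₂)
open import Data.Empty using (⊥; ⊥-elim)
open import Data.Unit using (tt)
open import Function using (_∘_; flip)
open import Data.Nat.Solver using (module +-*-Solver)
open import Data.Fin using (Fin; toℕ; fromℕ<; splitAt; _↑ˡ_; _↑ʳ_; join) renaming (zero to fz; suc to fs)
open import Data.Fin.Properties
  using (toℕ-↑ˡ; toℕ-↑ʳ; splitAt-↑ˡ; splitAt-↑ʳ; join-splitAt; toℕ-fromℕ<; toℕ<n; pigeonhole)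
open import Data.Fin.Permutation using (Permutation′; _⟨$⟩ʳ_)
open import Data.List using (List; []; _∷_; _++_; length; reverse; map; filterᵇ; cartesianProduct; allFin; tabulate)
open import Data.List.Properties
  using (filter-++; filter-accept; filter-reject; reverse-involutive; unfold-reverse; length-++; map-++; ++-assoc; ++-identityʳ;
         length-map; map-∘)
open import Data.List.Relation.Unary.All using (All; []; _∷_)
import Data.List.Relation.Unary.All as All
open import Data.List.Relation.Unary.All.Properties using (++⁺; ++⁻ˡ; ++⁻ʳ; map⁺)
open import Relation.Nullary using (¬_; Dec; yes; no)
open import Relation.Nullary.Decidable using (T?)
open import Relation.Binary.PropositionalEquality
open import Relation.Binary.Definitions using (Tri; tri<; tri≈; tri>)
open import Relation.Binary.Construct.Closure.ReflexiveTransitive using (ε; _◅_; _◅◅_; gmap)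
import Relation.Binary.Construct.Closure.ReflexiveTransitive as Star

≡ᵇ-refl : ∀ m → (m ≡ᵇ m) ≡ true
≡ᵇ-refl zero    = refl
≡ᵇ-refl (suc m) = ≡ᵇ-refl m

≢⇒≡ᵇ-false : ∀ m n → m ≢ n → (m ≡ᵇ n) ≡ false
≢⇒≡ᵇ-false zero    zero    m≢n = ⊥-elim (m≢n refl)
≢⇒≡ᵇ-false zero    (suc n) _   = refl
≢⇒≡ᵇ-false (suc m) zero    _   = refl
≢⇒≡ᵇ-false (suc m) (suc n) m≢n = ≢⇒≡ᵇ-false m n (m≢n ∘ cong suc)

<⇒<ᵇ-true : ∀ {m n} → m < n → (m <ᵇ n) ≡ true
<⇒<ᵇ-true {zero}  {suc n} _         = refl
<⇒<ᵇ-true {suc m} {suc n} (s≤s m<n) = <⇒<ᵇ-true m<n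

≥⇒<ᵇ-false : ∀ {m n} → n ≤ m → (m <ᵇ n) ≡ false
≥⇒<ᵇ-false {m}     {zero}  _         = refl
≥⇒<ᵇ-false {suc m} {suc n} (s≤s n≤m) = ≥⇒<ᵇ-false n≤m

<ᵇ-true⇒< : ∀ {m n} → (m <ᵇ n) ≡ true → m < n
<ᵇ-true⇒< {m} {n} e = <ᵇ⇒< m n (subst T (sym e) tt)

<ᵇ-false⇒≥ : ∀ {m n} → (m <ᵇ n) ≡ false → n ≤ m
<ᵇ-false⇒≥ {m} {n} e = ≮⇒≥ (λ m<n → true≢false (trans (sym (<⇒<ᵇ-true m<n)) e))
  where
  true≢false : true ≢ false
  true≢false ()

-- Adjacent transpositions and the evaluation of words

s-cases : ∀ q m → (m ≡ q × s (suc q) m ≡ suc q)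
                ⊎ (m ≡ suc q × s (suc q) m ≡ q)
                ⊎ (m ≢ q × m ≢ suc q × s (suc q) m ≡ m)
s-cases q m with m ≟ q
... | yes refl rewrite ≡ᵇ-refl m = inj₁ (refl , refl)
... | no m≢q rewrite ≢⇒≡ᵇ-false m q m≢q with m ≟ suc q
...   | yes refl rewrite ≡ᵇ-refl m = inj₂ (inj₁ (refl , refl))
...   | no m≢1+q rewrite ≢⇒≡ᵇ-false m (suc q) m≢1+q = inj₂ (inj₂ (m≢q , m≢1+q , refl))

s-lower : ∀ q → s (suc q) q ≡ suc q
s-lower q rewrite ≡ᵇ-refl q = refl

s-upper : ∀ q → s (suc q) (suc q) ≡ q
s-upper q rewrite ≢⇒≡ᵇ-false (suc q) q 1+n≢n | ≡ᵇ-refl q = refl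

s-other : ∀ q m → m ≢ q → m ≢ suc q → s (suc q) m ≡ m
s-other q m m≢q m≢1+q with s-cases q m
... | inj₁ (e , _)              = ⊥-elim (m≢q e)
... | inj₂ (inj₁ (e , _))       = ⊥-elim (m≢1+q e)
... | inj₂ (inj₂ (_ , _ , e))   = e

-- Letter 0 is not a letter of [n-1]; s 0 is the identity.
s-zero : ∀ m → s 0 m ≡ m
s-zero zero    = refl
s-zero (suc m) = refl

s-involutive : ∀ r m → s r (s r m) ≡ m
s-involutive zero    m rewrite s-zero m = s-zero m
s-involutive (suc q) m with s-cases q m
... | inj₁ (refl , e)          rewrite e = s-upper q
... | inj₂ (inj₁ (refl , e))   rewrite e = s-lower q
... | inj₂ (inj₂ (_ , _ , e))  rewrite e = e

s-fixes-below : ∀ {r m} → suc m < r → s r m ≡ m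
s-fixes-below {suc q} {m} (s≤s m<q) =
  s-other q m (λ e → <-irrefl e m<q) (λ e → <-irrefl e (<-trans m<q (n<1+n q)))

s-fixes-above : ∀ {r m} → r < m → s r m ≡ m
s-fixes-above {zero}  {m} _   = s-zero m
s-fixes-above {suc q} {m} r<m =
  s-other q m (λ { refl → <-asym r<m (n<1+n _) }) (λ { refl → <-irrefl refl r<m })

s-< : ∀ {r n m} → r < n → m < n → s r m < n
s-< {zero}  {n} {m} _   m<n rewrite s-zero m = m<n
s-< {suc q} {n} {m} r<n m<n with s-cases q m
... | inj₁ (_ , e)             rewrite e = r<n
... | inj₂ (inj₁ (_ , e))      rewrite e = <-trans (n<1+n q) r<n
... | inj₂ (inj₂ (_ , _ , e))  rewrite e = m<n

s-monotone : ∀ q {x y} → x < y → ¬ (x ≡ q × y ≡ suc q) → s (suc q) x < s (suc q) y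
s-monotone q {x} {y} x<y not-qq' with s-cases q x | s-cases q y
... | inj₁ (refl , _)         | inj₁ (refl , _)         = ⊥-elim (<-irrefl refl x<y)
... | inj₁ (refl , _)         | inj₂ (inj₁ (refl , _))  = ⊥-elim (not-qq' (refl , refl))
... | inj₁ (refl , e₁)        | inj₂ (inj₂ (_ , y≢1+q , e₂)) rewrite e₁ | e₂ = ≤∧≢⇒< x<y (y≢1+q ∘ sym)
... | inj₂ (inj₁ (refl , _))  | inj₁ (refl , _)         = ⊥-elim (<-asym x<y (n<1+n q))
... | inj₂ (inj₁ (refl , _))  | inj₂ (inj₁ (refl , _))  = ⊥-elim (<-irrefl refl x<y)
... | inj₂ (inj₁ (refl , e₁)) | inj₂ (inj₂ (_ , _ , e₂)) rewrite e₁ | e₂ = <-trans (n<1+n q) x<y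
... | inj₂ (inj₂ (_ , _ , e₁)) | inj₁ (refl , e₂)       rewrite e₁ | e₂ = <-trans x<y (n<1+n y)
... | inj₂ (inj₂ (x≢q , _ , e₁)) | inj₂ (inj₁ (refl , e₂)) rewrite e₁ | e₂ = ≤∧≢⇒< (≤-pred x<y) x≢q
... | inj₂ (inj₂ (_ , _ , e₁)) | inj₂ (inj₂ (_ , _ , e₂)) rewrite e₁ | e₂ = x<y

s-preserves-<ᵇ : ∀ q x y → x ≢ y → ¬ (x ≡ q × y ≡ suc q) → ¬ (y ≡ q × x ≡ suc q)
               → (s (suc q) y <ᵇ s (suc q) x) ≡ (y <ᵇ x)
s-preserves-<ᵇ q x y x≢y not-xy not-yx with <-cmp x y
... | tri< x<y _ _ = trans (≥⇒<ᵇ-false (<⇒≤ (s-monotone q x<y not-xy))) (sym (≥⇒<ᵇ-false (<⇒≤ x<y)))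
... | tri≈ _ x≡y _ = ⊥-elim (x≢y x≡y)
... | tri> _ _ y<x = trans (<⇒<ᵇ-true (s-monotone q y<x not-yx)) (sym (<⇒<ᵇ-true y<x))

s-comm : ∀ {j k} → FarApart j k → ∀ m → s j (s k m) ≡ s k (s j m)
s-comm {j} {k} (inj₁ j+1<k) m = s-comm-< j k j+1<k m
  where
  s-comm-< : ∀ j k → suc j < k → ∀ m → s j (s k m) ≡ s k (s j m)
  s-comm-< zero k _ m rewrite s-zero m | s-zero (s k m) = refl
  s-comm-< (suc p) (suc q) (s≤s p+1<q) m with s-cases q m
  ... | inj₁ (refl , e) rewrite e | s-fixes-above {suc p} {suc m} (<-trans p+1<q (n<1+n m))
                              | s-fixes-above {suc p} {m} p+1<q | s-lower m = refl
  ... | inj₂ (inj₁ (refl , e)) rewrite e | s-fixes-above {suc p} {q} p+1<q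
                              | s-fixes-above {suc p} {suc q} (<-trans p+1<q (n<1+n q)) | s-upper q = refl
  ... | inj₂ (inj₂ (_ , _ , e)) rewrite e with s-cases p m
  ...   | inj₁ (refl , e₂) rewrite e₂ | s-fixes-below {suc q} {suc m} (s≤s p+1<q) = refl
  ...   | inj₂ (inj₁ (refl , e₂)) rewrite e₂ | s-fixes-below {suc q} {p} (s≤s (<⇒≤ p+1<q)) = refl
  ...   | inj₂ (inj₂ (_ , _ , e₂)) rewrite e₂ | e = refl
s-comm {j} {k} (inj₂ k+1<j) m = sym (s-comm (inj₁ k+1<j) m)

s-shift : ∀ {a r} → a < r → ∀ m → s r (a + m) ≡ a + s (r ∸ a) m
s-shift {a} {r} a<r m with r ∸ a | m+[n∸m]≡n (<⇒≤ a<r) | m<n⇒0<n∸m a<r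
... | suc q | refl | _ with s-cases q m
...   | inj₁ (refl , e)          rewrite e = trans (cong (λ r → s r (a + m)) (+-suc a m)) (trans (s-lower (a + m)) (sym (+-suc a m)))
...   | inj₂ (inj₁ (refl , e))   rewrite e | +-suc a q = s-upper (a + q)
...   | inj₂ (inj₂ (m≢q , m≢1+q , e)) rewrite e | +-suc a q =
  s-other (a + q) (a + m) (m≢q ∘ +-cancelˡ-≡ a _ _) (m≢1+q ∘ +-cancelˡ-≡ a _ _ ∘ flip trans (sym (+-suc a q)))

evalW-++ : ∀ w v m → evalW (w ++ v) m ≡ evalW w (evalW v m)
evalW-++ []      v m = refl
evalW-++ (r ∷ w) v m = cong (s r) (evalW-++ w v m)

evalW-reverseʳ : ∀ w m → evalW w (evalW (reverse w) m) ≡ m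
evalW-reverseʳ []      m = refl
evalW-reverseʳ (r ∷ w) m
  rewrite unfold-reverse r w | evalW-++ (reverse w) (r ∷ []) m | evalW-reverseʳ w (s r m) = s-involutive r m

evalW-reverseˡ : ∀ w m → evalW (reverse w) (evalW w m) ≡ m
evalW-reverseˡ w m =
  subst (λ v → evalW (reverse w) (evalW v m) ≡ m) (reverse-involutive w) (evalW-reverseʳ (reverse w) m)

evalW-injective : ∀ w {x y} → evalW w x ≡ evalW w y → x ≡ y
evalW-injective w {x} {y} e = begin
  x                                ≡⟨ evalW-reverseˡ w x ⟨
  evalW (reverse w) (evalW w x)    ≡⟨ cong (evalW (reverse w)) e ⟩
  evalW (reverse w) (evalW w y)    ≡⟨ evalW-reverseˡ w y ⟩
  y                                ∎
  where open ≡-Reasoning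

evalW-< : ∀ {n} w → All (_< n) w → ∀ {m} → m < n → evalW w m < n
evalW-< []      []             m<n = m<n
evalW-< (r ∷ w) (r<n ∷ w<n) m<n = s-< r<n (evalW-< w w<n m<n)

evalW-fixes-≥ : ∀ {n} w → All (_< n) w → ∀ {m} → n ≤ m → evalW w m ≡ m
evalW-fixes-≥ []      []          _   = refl
evalW-fixes-≥ (r ∷ w) (r<n ∷ w<n) n≤m rewrite evalW-fixes-≥ w w<n n≤m = s-fixes-above (<-≤-trans r<n n≤m)

evalW-reverse-< : ∀ {n} w → All (_< n) w → ∀ {m} → m < n → evalW (reverse w) m < n
evalW-reverse-< {n} w w<n {m} m<n with evalW (reverse w) m <? n
... | yes lt = lt
... | no ≮n = ⊥-elim (≮n (subst (_< n) (sym (trans (sym (evalW-fixes-≥ w w<n (≮⇒≥ ≮n))) (evalW-reverseʳ w m))) m<n))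

-- Inversion counts

sum< : ℕ → (ℕ → ℕ) → ℕ
sum< zero    f = 0
sum< (suc n) f = f 0 + sum< n (f ∘ suc)

sum<-cong : ∀ n {f g} → (∀ i → i < n → f i ≡ g i) → sum< n f ≡ sum< n g
sum<-cong zero    f≗g = refl
sum<-cong (suc n) f≗g = cong₂ _+_ (f≗g 0 z<s) (sum<-cong n (λ i i<n → f≗g (suc i) (s<s i<n)))

sum<-+ : ∀ a b f → sum< (a + b) f ≡ sum< a f + sum< b (f ∘ (a +_))
sum<-+ zero    b f = refl
sum<-+ (suc a) b f rewrite sum<-+ a b (f ∘ suc) = sym (+-assoc (f 0) _ _)

sum<-zero : ∀ n {f} → (∀ i → i < n → f i ≡ 0) → sum< n f ≡ 0
sum<-zero zero    f≡0 = refl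
sum<-zero (suc n) f≡0 rewrite f≡0 0 z<s = sum<-zero n (λ i i<n → f≡0 (suc i) (s<s i<n))

≤-sum< : ∀ n f {p} → p < n → f p ≤ sum< n f
≤-sum< (suc n) f {zero}  _         = m≤m+n (f 0) _
≤-sum< (suc n) f {suc p} (s<s p<n) = ≤-trans (≤-sum< n (f ∘ suc) p<n) (m≤n+m _ (f 0))

sum<-mono-≤ : ∀ n {f g} → (∀ i → i < n → f i ≤ g i) → sum< n f ≤ sum< n g
sum<-mono-≤ zero    f≤g = z≤n
sum<-mono-≤ (suc n) f≤g = +-mono-≤ (f≤g 0 z<s) (sum<-mono-≤ n (λ i i<n → f≤g (suc i) (s<s i<n)))

-- Stated with the odd terms moved across, so that no subtraction occurs.
sum<-update : ∀ n {f g} p → p < n → (∀ i → i < n → i ≢ p → f i ≡ g i) → sum< n f + g p ≡ sum< n g + f p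
sum<-update (suc n) {f} {g} zero _ f≗g = begin
  f 0 + sum< n (f ∘ suc) + g 0   ≡⟨ cong (λ t → f 0 + t + g 0) (sum<-cong n (λ i i<n → f≗g (suc i) (s<s i<n) λ ())) ⟩
  f 0 + sum< n (g ∘ suc) + g 0   ≡⟨ +-comm (f 0 + _) (g 0) ⟩
  g 0 + (f 0 + sum< n (g ∘ suc)) ≡⟨ cong (g 0 +_) (+-comm (f 0) _) ⟩
  g 0 + (sum< n (g ∘ suc) + f 0) ≡⟨ +-assoc (g 0) _ _ ⟨
  g 0 + sum< n (g ∘ suc) + f 0   ∎
  where open ≡-Reasoning
sum<-update (suc n) {f} {g} (suc p) (s<s p<n) f≗g = begin
  f 0 + sum< n (f ∘ suc) + g (suc p)   ≡⟨ +-assoc (f 0) _ _ ⟩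
  f 0 + (sum< n (f ∘ suc) + g (suc p)) ≡⟨ cong₂ _+_ (f≗g 0 z<s λ ())
                                                    (sum<-update n p p<n λ i i<n i≢p →
                                                      f≗g (suc i) (s<s i<n) (i≢p ∘ suc-injective)) ⟩
  g 0 + (sum< n (g ∘ suc) + f (suc p)) ≡⟨ +-assoc (g 0) _ _ ⟨
  g 0 + sum< n (g ∘ suc) + f (suc p)   ∎
  where open ≡-Reasoning

sum<² : ℕ → (ℕ → ℕ → ℕ) → ℕ
sum<² n F = sum< n (λ i → sum< n (F i))

≤-sum<² : ∀ n F {i j} → i < n → j < n → F i j ≤ sum<² n F
≤-sum<² n F i<n j<n = ≤-trans (≤-sum< n (F _) j<n) (≤-sum< n (λ i → sum< n (F i)) i<n)

sum<²-update : ∀ n {F G} u v → u < n → v < n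
  → (∀ i j → i < n → j < n → (i ≢ u ⊎ j ≢ v) → F i j ≡ G i j)
  → sum<² n F + G u v ≡ sum<² n G + F u v
sum<²-update n {F} {G} u v u<n v<n F≗G = +-cancelʳ-≡ (sum< n (G u)) _ _ (begin
  sum<² n F + G u v + sum< n (G u)     ≡⟨ +-assoc (sum<² n F) _ _ ⟩
  sum<² n F + (G u v + sum< n (G u))   ≡⟨ cong (sum<² n F +_) (+-comm (G u v) _) ⟩
  sum<² n F + (sum< n (G u) + G u v)   ≡⟨ +-assoc (sum<² n F) _ _ ⟨
  sum<² n F + sum< n (G u) + G u v     ≡⟨ cong (_+ G u v) outer ⟩
  sum<² n G + sum< n (F u) + G u v     ≡⟨ +-assoc (sum<² n G) _ _ ⟩
  sum<² n G + (sum< n (F u) + G u v)   ≡⟨ cong (sum<² n G +_) row ⟩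
  sum<² n G + (sum< n (G u) + F u v)   ≡⟨ cong (sum<² n G +_) (+-comm _ (F u v)) ⟩
  sum<² n G + (F u v + sum< n (G u))   ≡⟨ +-assoc (sum<² n G) _ _ ⟨
  sum<² n G + F u v + sum< n (G u)     ∎)
  where
  open ≡-Reasoning
  row : sum< n (F u) + G u v ≡ sum< n (G u) + F u v
  row = sum<-update n v v<n (λ j j<n j≢v → F≗G u j u<n j<n (inj₂ j≢v))
  outer : sum<² n F + sum< n (G u) ≡ sum<² n G + sum< n (F u)
  outer = sum<-update n u u<n (λ i i<n i≢u → sum<-cong n (λ j j<n → F≗G i j i<n j<n (inj₁ i≢u)))

boolToℕ : Bool → ℕ
boolToℕ true  = 1
boolToℕ false = 0

boolToℕ≤1 : ∀ b → boolToℕ b ≤ 1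
boolToℕ≤1 true  = s≤s z≤n
boolToℕ≤1 false = z≤n

-- Permutations are studied through functions h : ℕ → ℕ, inspected on [0, n).
isInversion : (ℕ → ℕ) → ℕ → ℕ → Bool
isInversion h i j = (i <ᵇ j) ∧ (h j <ᵇ h i)

inversionAt : (ℕ → ℕ) → ℕ → ℕ → ℕ
inversionAt h i j = boolToℕ (isInversion h i j)

crossInversionAt : ℕ → (ℕ → ℕ) → ℕ → ℕ → ℕ
crossInversionAt a h i j = if i <ᵇ a then (if j <ᵇ a then 0 else inversionAt h i j) else 0

inversions : ℕ → (ℕ → ℕ) → ℕ
inversions n h = sum<² n (inversionAt h)

crossInversions : ℕ → ℕ → (ℕ → ℕ) → ℕ
crossInversions a n h = sum<² n (crossInversionAt a h)

crossInversionAt≤inversionAt : ∀ a h i j → crossInversionAt a h i j ≤ inversionAt h i j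
crossInversionAt≤inversionAt a h i j with i <ᵇ a | j <ᵇ a
... | true  | true  = z≤n
... | true  | false = ≤-refl
... | false | _     = z≤n

inversions-cong : ∀ n {h h'} → (∀ i → i < n → h i ≡ h' i) → inversions n h ≡ inversions n h'
inversions-cong n h≗h' = sum<-cong n λ i i<n → sum<-cong n λ j j<n →
  cong₂ (λ x y → boolToℕ ((i <ᵇ j) ∧ (x <ᵇ y))) (h≗h' j j<n) (h≗h' i i<n)

inversions-id : ∀ n → inversions n (λ x → x) ≡ 0
inversions-id n = sum<-zero n λ i _ → sum<-zero n λ j _ → no-inversion i j
  where
  no-inversion : ∀ i j → inversionAt (λ x → x) i j ≡ 0
  no-inversion i j with i <ᵇ j in i<ᵇj
  ... | false = refl
  ... | true rewrite ≥⇒<ᵇ-false {j} {i} (<⇒≤ (<ᵇ-true⇒< i<ᵇj)) = refl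

crossInversion-counted : ∀ {a n h i j} → i < a → a ≤ j → j < n → h j < h i → 1 ≤ crossInversions a n h
crossInversion-counted {a} {n} {h} {i} {j} i<a a≤j j<n hj<hi =
  ≤-trans (≤-reflexive (sym counted)) (≤-sum<² n (crossInversionAt a h) (<-≤-trans i<a (≤-trans a≤j (<⇒≤ j<n))) j<n)
  where
  counted : crossInversionAt a h i j ≡ 1
  counted rewrite <⇒<ᵇ-true i<a | ≥⇒<ᵇ-false {j} {a} a≤j | <⇒<ᵇ-true (<-≤-trans i<a a≤j) | <⇒<ᵇ-true hj<hi = refl

inversionAt-after-s : ∀ {h q u v} → (∀ {x y} → h x ≡ h y → x ≡ y) → u < v
  → (h u ≡ q × h v ≡ suc q) ⊎ (h u ≡ suc q × h v ≡ q)
  → ∀ i j → (i ≢ u ⊎ j ≢ v) → inversionAt (s (suc q) ∘ h) i j ≡ inversionAt h i j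
inversionAt-after-s {h} {q} {u} {v} h-inj u<v uv i j ij≢uv with i <ᵇ j in i<ᵇj
... | false = refl
... | true  = cong boolToℕ (s-preserves-<ᵇ q (h i) (h j) (<-irrefl′ ∘ h-inj) (not-swapped uv) (not-swapped′ uv))
  where
  i<j = <ᵇ-true⇒< i<ᵇj
  <-irrefl′ : i ≢ j
  <-irrefl′ i≡j = <-irrefl i≡j i<j
  ij≡uv : i ≡ u → j ≡ v → ⊥
  ij≡uv refl refl = [ (λ i≢i → i≢i refl) , (λ j≢j → j≢j refl) ]′ ij≢uv
  not-swapped : (h u ≡ q × h v ≡ suc q) ⊎ (h u ≡ suc q × h v ≡ q) → ¬ (h i ≡ q × h j ≡ suc q)
  not-swapped (inj₁ (hu , hv)) (hi , hj) = ij≡uv (h-inj (trans hi (sym hu))) (h-inj (trans hj (sym hv)))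
  not-swapped (inj₂ (hu , hv)) (hi , hj) with h-inj (trans hi (sym hv)) | h-inj (trans hj (sym hu))
  ... | refl | refl = <-asym u<v i<j
  not-swapped′ : (h u ≡ q × h v ≡ suc q) ⊎ (h u ≡ suc q × h v ≡ q) → ¬ (h j ≡ q × h i ≡ suc q)
  not-swapped′ (inj₂ (hu , hv)) (hj , hi) = ij≡uv (h-inj (trans hi (sym hu))) (h-inj (trans hj (sym hv)))
  not-swapped′ (inj₁ (hu , hv)) (hj , hi) with h-inj (trans hi (sym hv)) | h-inj (trans hj (sym hu))
  ... | refl | refl = <-asym u<v i<j

record OneLetterStep (n a : ℕ) (h g : ℕ → ℕ) : Set where
  field
    u v               : ℕ
    v<n               : v < n
    u<v               : u < v
    inversions-update : inversions n g + inversionAt h u v ≡ inversions n h + inversionAt g u v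
    crossings-update  : crossInversions a n g + crossInversionAt a h u v
                        ≡ crossInversions a n h + crossInversionAt a g u v

oneLetterStep : ∀ {n} a q w → All (_< n) w → suc q < n → OneLetterStep n a (evalW w) (evalW (suc q ∷ w))
oneLetterStep {n} a q w w<n q+1<n = by-position (<-cmp p p')
  where
  p  = evalW (reverse w) q
  p' = evalW (reverse w) (suc q)
  at : ∀ {u v} → u < v → v < n → (evalW w u ≡ q × evalW w v ≡ suc q) ⊎ (evalW w u ≡ suc q × evalW w v ≡ q)
     → OneLetterStep n a (evalW w) (evalW (suc q ∷ w))
  at {u} {v} u<v v<n uv = record
    { u = u ; v = v ; v<n = v<n ; u<v = u<v
    ; inversions-update = sum<²-update n u v (<-trans u<v v<n) v<n λ i j _ _ ij≢uv → agree i j ij≢uv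
    ; crossings-update  = sum<²-update n u v (<-trans u<v v<n) v<n λ i j _ _ ij≢uv →
        cong (λ t → if i <ᵇ a then (if j <ᵇ a then 0 else t) else 0) (agree i j ij≢uv) }
    where
    agree = inversionAt-after-s (evalW-injective w) u<v uv
  by-position : Tri (p < p') (p ≡ p') (p' < p) → OneLetterStep n a (evalW w) (evalW (suc q ∷ w))
  by-position (tri< p<p' _ _) = at p<p' (evalW-reverse-< w w<n q+1<n) (inj₁ (evalW-reverseʳ w q , evalW-reverseʳ w (suc q)))
  by-position (tri≈ _ p≡p' _) = ⊥-elim (1+n≢n (sym (trans (sym (evalW-reverseʳ w q))
                                  (trans (cong (evalW w) p≡p') (evalW-reverseʳ w (suc q))))))
  by-position (tri> _ _ p'<p) = at p'<p (evalW-reverse-< w w<n (<-trans (n<1+n q) q+1<n))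
                                  (inj₂ (evalW-reverseʳ w (suc q) , evalW-reverseʳ w q))

module _ {n a h g} (st : OneLetterStep n a h g) where
  open OneLetterStep st

  inversions-step-≤ : inversions n g ≤ suc (inversions n h)
  inversions-step-≤ = begin
    inversions n g                      ≤⟨ m≤m+n _ _ ⟩
    inversions n g + inversionAt h u v  ≡⟨ inversions-update ⟩
    inversions n h + inversionAt g u v  ≤⟨ +-monoʳ-≤ (inversions n h) (boolToℕ≤1 _) ⟩
    inversions n h + 1                  ≡⟨ +-comm _ 1 ⟩
    suc (inversions n h)                ∎
    where open ≤-Reasoning

  -- A step that creates an inversion removes none, so it cannot remove a crossing one either.
  crossInversions-step-mono : inversions n g ≡ suc (inversions n h) → crossInversions a n h ≤ crossInversions a n g
  crossInversions-step-mono g≡1+h = begin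
    crossInversions a n h                             ≤⟨ m≤m+n _ _ ⟩
    crossInversions a n h + crossInversionAt a g u v  ≡⟨ crossings-update ⟨
    crossInversions a n g + crossInversionAt a h u v  ≡⟨ cong (crossInversions a n g +_) uv-not-crossing ⟩
    crossInversions a n g + 0                         ≡⟨ +-identityʳ _ ⟩
    crossInversions a n g                             ∎
    where
    open ≤-Reasoning
    uv-not-inversion : inversionAt h u v ≡ 0
    uv-not-inversion = n≤0⇒n≡0 (≤-pred (≤-trans (≤-reflexive created) (boolToℕ≤1 _)))
      where
      created : suc (inversionAt h u v) ≡ inversionAt g u v
      created = +-cancelˡ-≡ (inversions n h) _ _
        (trans (+-suc _ _) (trans (cong (_+ inversionAt h u v) (sym g≡1+h)) inversions-update))
    uv-not-crossing : crossInversionAt a h u v ≡ 0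
    uv-not-crossing = n≤0⇒n≡0 (≤-trans (crossInversionAt≤inversionAt a h u v) (≤-reflexive uv-not-inversion))

Letter⇒< : ∀ {n} w → All (Letter n) w → All (_< n) w
Letter⇒< w = All.map proj₂

inversions-≤-length : ∀ {n} w → All (Letter n) w → inversions n (evalW w) ≤ length w
inversions-≤-length {n} []            []                         = ≤-reflexive (inversions-id n)
inversions-≤-length {n} (suc q ∷ w) ((_ , q+1<n) ∷ w-letters) =
  ≤-trans (inversions-step-≤ (oneLetterStep 0 q w (Letter⇒< w w-letters) q+1<n)) (s≤s (inversions-≤-length w w-letters))

ℕ-pigeonhole : ∀ {m k} (f : ℕ → ℕ) → k < m → (∀ i → i < m → f i < k) → (∀ {i j} → f i ≡ f j → i ≡ j) → ⊥
ℕ-pigeonhole f k<m f<k f-inj with pigeonhole k<m (λ i → fromℕ< (f<k (toℕ i) (toℕ<n i)))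
... | i , j , i<j , fi≡fj = <-irrefl (f-inj (trans (sym (toℕ-fromℕ< _)) (trans (cong toℕ fi≡fj) (toℕ-fromℕ< _)))) i<j

-- Let p and p' be the positions of the values q and a = q + 1. If they lie on different sides of a,
-- then h or s_a ∘ h has a crossing inversion at (p , p'); if both lie below a (resp. at or above a),
-- the absence of crossings forces h to map a + 1 positions into a values (resp. a positions into q).
s-creates-crossing : ∀ {n} q w → All (_< n) w → suc q < n
  → crossInversions (suc q) n (evalW w) ≡ 0 → crossInversions (suc q) n (evalW (suc q ∷ w)) ≡ 0 → ⊥
s-creates-crossing {n} q w w<n a<n no-crossing no-crossing' = by-sides (p <? a) (p' <? a)
  where
  a = suc q
  h = evalW w
  h⁻¹ = evalW (reverse w)
  p  = h⁻¹ q
  p' = h⁻¹ a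
  hp : h p ≡ q
  hp = evalW-reverseʳ w q
  hp' : h p' ≡ a
  hp' = evalW-reverseʳ w a
  p<n : p < n
  p<n = evalW-reverse-< w w<n (<-trans (n<1+n q) a<n)
  p'<n : p' < n
  p'<n = evalW-reverse-< w w<n a<n
  no-crossing-in : ∀ f → crossInversions a n f ≡ 0 → ∀ {i j} → i < a → a ≤ j → j < n → f j < f i → ⊥
  no-crossing-in f f-clean i<a a≤j j<n fj<fi = 1+n≰n (≤-trans (crossInversion-counted i<a a≤j j<n fj<fi) (≤-reflexive f-clean))
  by-sides : Dec (p < a) → Dec (p' < a) → ⊥
  by-sides (yes p<a) (no p'≮a) = no-crossing-in (evalW (a ∷ w)) no-crossing' p<a (≮⇒≥ p'≮a) p'<n swapped
    where
    swapped : s a (h p') < s a (h p)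
    swapped rewrite hp | hp' = subst₂ _<_ (sym (s-upper q)) (sym (s-lower q)) (n<1+n q)
  by-sides (no p≮a) (yes p'<a) = no-crossing-in h no-crossing p'<a (≮⇒≥ p≮a) p<n (subst₂ _<_ (sym hp) (sym hp') (n<1+n q))
  by-sides (yes p<a) (yes p'<a) = ℕ-pigeonhole h⁻¹ (n<1+n a) below (evalW-injective (reverse w))
    where
    below : ∀ x → x < suc a → h⁻¹ x < a
    below x x≤a with h⁻¹ x <? a | m≤n⇒m<n∨m≡n (≤-pred x≤a)
    ... | yes lt | _ = lt
    ... | no ≮a | inj₁ x<a = ⊥-elim (no-crossing-in h no-crossing p'<a (≮⇒≥ ≮a) (evalW-reverse-< w w<n (<-trans x<a a<n))
                                       (subst₂ _<_ (sym (evalW-reverseʳ w x)) (sym hp') x<a))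
    ... | no ≮a | inj₂ refl = ⊥-elim (≮a p'<a)
  by-sides (no p≮a) (no p'≮a) = ℕ-pigeonhole h (n<1+n q) below (evalW-injective w)
    where
    below : ∀ i → i < a → h i < q
    below i i<a with <-cmp (h i) q
    ... | tri< lt _ _   = lt
    ... | tri≈ _ hi≡q _ = ⊥-elim (p≮a (subst (_< a) (trans (sym (evalW-reverseˡ w i)) (cong h⁻¹ hi≡q)) i<a))
    ... | tri> _ _ q<hi = ⊥-elim (no-crossing-in h no-crossing i<a (≮⇒≥ p≮a) p<n (subst (_< h i) (sym hp) q<hi))

reduced-avoids-split : ∀ {n} a w → All (Letter n) w → inversions n (evalW w) ≡ length w
  → crossInversions a n (evalW w) ≡ 0 → All (_≢ a) w
reduced-avoids-split a []            []                        _        _         = []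
reduced-avoids-split {n} a (suc q ∷ w) ((_ , q+1<n) ∷ w-letters) inv≡len no-cross =
  q+1≢a ∷ reduced-avoids-split a w w-letters inv≡len' no-cross'
  where
  first = oneLetterStep a q w (Letter⇒< w w-letters) q+1<n
  inv≡len' : inversions n (evalW w) ≡ length w
  inv≡len' = ≤-antisym (inversions-≤-length w w-letters)
                       (≤-pred (≤-trans (≤-reflexive (sym inv≡len)) (inversions-step-≤ first)))
  no-cross' : crossInversions a n (evalW w) ≡ 0
  no-cross' = n≤0⇒n≡0 (≤-trans (crossInversions-step-mono first (trans inv≡len (cong suc (sym inv≡len'))))
                               (≤-reflexive no-cross))
  q+1≢a : suc q ≢ a
  q+1≢a refl = s-creates-crossing q w (Letter⇒< w w-letters) q+1<n no-cross' no-cross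

count : ∀ {A : Set} → (A → Bool) → List A → ℕ
count P xs = length (filterᵇ P xs)

count-∷ : ∀ {A : Set} (P : A → Bool) x xs → count P (x ∷ xs) ≡ boolToℕ (P x) + count P xs
count-∷ P x xs with P x
... | true  = refl
... | false = refl

count-++ : ∀ {A : Set} (P : A → Bool) xs ys → count P (xs ++ ys) ≡ count P xs + count P ys
count-++ P []       ys = refl
count-++ P (x ∷ xs) ys
  rewrite count-∷ P x (xs ++ ys) | count-∷ P x xs | count-++ P xs ys = sym (+-assoc (boolToℕ (P x)) _ _)

count-map : ∀ {A B : Set} (P : B → Bool) (f : A → B) xs → count P (map f xs) ≡ count (P ∘ f) xs
count-map P f []       = refl
count-map P f (x ∷ xs) rewrite count-∷ P (f x) (map f xs) | count-∷ (P ∘ f) x xs | count-map P f xs = refl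

count-tabulate : ∀ {A : Set} n (g : Fin n → A) (P : A → Bool) (Q : ℕ → ℕ)
  → (∀ x → boolToℕ (P (g x)) ≡ Q (toℕ x)) → count P (tabulate g) ≡ sum< n Q
count-tabulate zero    g P Q PQ = refl
count-tabulate (suc n) g P Q PQ =
  trans (count-∷ P (g fz) (tabulate (g ∘ fs))) (cong₂ _+_ (PQ fz) (count-tabulate n (g ∘ fs) P (Q ∘ suc) (PQ ∘ fs)))

count-cartesianProduct : ∀ {A B : Set} n (g : Fin n → A) (ys : List B) (P : A × B → Bool) (Q : ℕ → ℕ)
  → (∀ x → count (λ y → P (g x , y)) ys ≡ Q (toℕ x)) → count P (cartesianProduct (tabulate g) ys) ≡ sum< n Q
count-cartesianProduct zero    g ys P Q PQ = refl
count-cartesianProduct (suc n) g ys P Q PQ =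
  trans (count-++ P (map (g fz ,_) ys) (cartesianProduct (tabulate (g ∘ fs)) ys))
        (cong₂ _+_ (trans (count-map P (g fz ,_) ys) (PQ fz))
                   (count-cartesianProduct n (g ∘ fs) ys P (Q ∘ suc) (PQ ∘ fs)))

Represents : ∀ {n} → (ℕ → ℕ) → (Fin n → Fin n) → Set
Represents h f = ∀ i → h (toℕ i) ≡ toℕ (f i)

len≡inversions : ∀ {n} (f : Fin n → Fin n) h → Represents h f → len f ≡ inversions n h
len≡inversions {n} f h h≈f = count-cartesianProduct n (λ x → x) (allFin n) _ _ λ x →
  count-tabulate n (λ y → y) _ _ λ y →
    cong₂ (λ u v → boolToℕ ((toℕ x <ᵇ toℕ y) ∧ (u <ᵇ v))) (sym (h≈f y)) (sym (h≈f x))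

↑ˡ-or-↑ʳ : ∀ a b (i : Fin (a + b)) → (∃[ j ] i ≡ j ↑ˡ b) ⊎ (∃[ j ] i ≡ a ↑ʳ j)
↑ˡ-or-↑ʳ a b i with splitAt a i in e
... | inj₁ j = inj₁ (j , trans (sym (join-splitAt a b i)) (cong (join a b) e))
... | inj₂ j = inj₂ (j , trans (sym (join-splitAt a b i)) (cong (join a b) e))

+-<ᵇ : ∀ a x y → (a + x <ᵇ a + y) ≡ (x <ᵇ y)
+-<ᵇ zero    x y = refl
+-<ᵇ (suc a) x y = +-<ᵇ a x y

inversions-+ : ∀ a b {h hα hβ} → (∀ i → i < a → h i ≡ hα i) → (∀ i → i < b → h (a + i) ≡ a + hβ i)
  → inversions a hα + inversions b hβ ≤ inversions (a + b) h
inversions-+ a b {h} {hα} {hβ} h≗hα h≗hβ = begin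
  inversions a hα + inversions b hβ
    ≡⟨ cong₂ _+_ (sym (inversions-cong a h≗hα)) β-block ⟩
  sum< a (λ i → sum< a (inversionAt h i)) + sum< b (λ i → sum< b (λ j → inversionAt h (a + i) (a + j)))
    ≤⟨ +-mono-≤ (sum<-mono-≤ a λ i _ → left-block i) (sum<-mono-≤ b λ i _ → right-block (a + i)) ⟩
  sum< a (λ i → sum< (a + b) (inversionAt h i)) + sum< b (λ i → sum< (a + b) (inversionAt h (a + i)))
    ≡⟨ sum<-+ a b _ ⟨
  inversions (a + b) h ∎
  where
  open ≤-Reasoning
  left-block : ∀ i → sum< a (inversionAt h i) ≤ sum< (a + b) (inversionAt h i)
  left-block i = subst (sum< a (inversionAt h i) ≤_) (sym (sum<-+ a b _)) (m≤m+n _ _)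
  right-block : ∀ i → sum< b (inversionAt h i ∘ (a +_)) ≤ sum< (a + b) (inversionAt h i)
  right-block i = subst (sum< b (inversionAt h i ∘ (a +_)) ≤_) (sym (sum<-+ a b _)) (m≤n+m _ _)
  β-block : inversions b hβ ≡ sum< b (λ i → sum< b (λ j → inversionAt h (a + i) (a + j)))
  β-block = sum<-cong b λ i i<b → sum<-cong b λ j j<b → cong boolToℕ (sym (cong₂ _∧_ (+-<ᵇ a i j)
              (trans (cong₂ _<ᵇ_ (h≗hβ j j<b) (h≗hβ i i<b)) (+-<ᵇ a (hβ j) (hβ i)))))

-- Reduced words of an inflation

-- A reduced word of 12[α,β] avoids the letter a = |α|; low and high recover its words for α and β.
low : ℕ → Word → Word
low a = filterᵇ (_<ᵇ a)

high : ℕ → Word → Word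
high a w = map (_∸ a) (filterᵇ (a <ᵇ_) w)

shift : ℕ → Word → Word
shift a = map (a +_)

data Side (a r : ℕ) : Set where
  below : r < a → Side a r
  above : a < r → Side a r

side : ∀ {a r} → r ≢ a → Side a r
side {a} {r} r≢a with <-cmp r a
... | tri< r<a _ _ = below r<a
... | tri≈ _ r≡a _ = ⊥-elim (r≢a r≡a)
... | tri> _ _ a<r = above a<r

module _ {a r : ℕ} (w : Word) where

  low-∷-< : r < a → low a (r ∷ w) ≡ r ∷ low a w
  low-∷-< r<a rewrite <⇒<ᵇ-true r<a = refl

  low-∷-≥ : a ≤ r → low a (r ∷ w) ≡ low a w
  low-∷-≥ a≤r rewrite ≥⇒<ᵇ-false a≤r = refl

  high-∷-≤ : r ≤ a → high a (r ∷ w) ≡ high a w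
  high-∷-≤ r≤a rewrite ≥⇒<ᵇ-false {a} {r} r≤a = refl

  high-∷-> : a < r → high a (r ∷ w) ≡ (r ∸ a) ∷ high a w
  high-∷-> a<r rewrite <⇒<ᵇ-true a<r = refl

low-++ : ∀ a u v → low a (u ++ v) ≡ low a u ++ low a v
low-++ a u v = filter-++ (T? ∘ (_<ᵇ a)) u v

high-++ : ∀ a u v → high a (u ++ v) ≡ high a u ++ high a v
high-++ a u v = trans (cong (map (_∸ a)) (filter-++ (T? ∘ (a <ᵇ_)) u v))
                      (map-++ (_∸ a) (filterᵇ (a <ᵇ_) u) (filterᵇ (a <ᵇ_) v))

low-of-low : ∀ {a} x → All (_< a) x → low a x ≡ x
low-of-low []      []            = refl
low-of-low (r ∷ x) (r<a ∷ x<a) = trans (low-∷-< x r<a) (cong (r ∷_) (low-of-low x x<a))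

high-of-low : ∀ {a} x → All (_< a) x → high a x ≡ []
high-of-low []      []            = refl
high-of-low (r ∷ x) (r<a ∷ x<a) = trans (high-∷-≤ x (<⇒≤ r<a)) (high-of-low x x<a)

low-shift : ∀ a y → low a (shift a y) ≡ []
low-shift a []      = refl
low-shift a (r ∷ y) = trans (low-∷-≥ (shift a y) (m≤m+n a r)) (low-shift a y)

high-shift : ∀ a y → All (1 ≤_) y → high a (shift a y) ≡ y
high-shift a []      []             = refl
high-shift a (r ∷ y) (1≤r ∷ 1≤y) = begin
  high a (a + r ∷ shift a y)      ≡⟨ high-∷-> (shift a y) (subst (_≤ a + r) (+-comm a 1) (+-monoʳ-≤ a 1≤r)) ⟩
  (a + r ∸ a) ∷ high a (shift a y) ≡⟨ cong₂ _∷_ (m+n∸m≡n a r) (high-shift a y 1≤y) ⟩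
  r ∷ y                            ∎
  where open ≡-Reasoning

low-< : ∀ a w → All (_< a) (low a w)
low-< a []      = []
low-< a (r ∷ w) with r <ᵇ a in r<ᵇa
... | true  = <ᵇ-true⇒< r<ᵇa ∷ low-< a w
... | false = low-< a w

low-Letter : ∀ a {n} w → All (Letter n) w → All (Letter a) (low a w)
low-Letter a []      []                         = []
low-Letter a (r ∷ w) ((1≤r , _) ∷ w-letters) with r <ᵇ a in r<ᵇa
... | true  = (1≤r , <ᵇ-true⇒< r<ᵇa) ∷ low-Letter a w w-letters
... | false = low-Letter a w w-letters

high-Letter : ∀ a {b} w → All (_< a + b) w → All (Letter b) (high a w)
high-Letter a []      []              = []
high-Letter a {b} (r ∷ w) (r<a+b ∷ w<a+b) with a <ᵇ r in a<ᵇr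
... | true  = (m<n⇒0<n∸m a<r , subst (r ∸ a <_) (m+n∸m≡n a b) (∸-monoˡ-< r<a+b (<⇒≤ a<r))) ∷ high-Letter a w w<a+b
  where a<r = <ᵇ-true⇒< {a} {r} a<ᵇr
... | false = high-Letter a w w<a+b

length-low+high : ∀ a w → All (_≢ a) w → length (low a w) + length (high a w) ≡ length w
length-low+high a []      []             = refl
length-low+high a (r ∷ w) (r≢a ∷ w≢a) with side r≢a
... | below r<a rewrite low-∷-< w r<a | high-∷-≤ w (<⇒≤ r<a) = cong suc (length-low+high a w w≢a)
... | above a<r rewrite low-∷-≥ w (<⇒≤ a<r) | high-∷-> w a<r =
  trans (+-suc (length (low a w)) _) (cong suc (length-low+high a w w≢a))

evalW-low : ∀ a w → All (_≢ a) w → ∀ {m} → m < a → evalW w m ≡ evalW (low a w) m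
evalW-low a []      []             m<a = refl
evalW-low a (r ∷ w) (r≢a ∷ w≢a) m<a with side r≢a
... | below r<a rewrite low-∷-< w r<a = cong (s r) (evalW-low a w w≢a m<a)
... | above a<r rewrite low-∷-≥ w (<⇒≤ a<r) | evalW-low a w w≢a m<a =
  s-fixes-below (≤-<-trans (evalW-< (low a w) (low-< a w) m<a) a<r)

evalW-high : ∀ a w → All (_≢ a) w → ∀ m → evalW w (a + m) ≡ a + evalW (high a w) m
evalW-high a []      []             m = refl
evalW-high a (r ∷ w) (r≢a ∷ w≢a) m with side r≢a
... | below r<a rewrite high-∷-≤ w (<⇒≤ r<a) | evalW-high a w w≢a m = s-fixes-above (<-≤-trans r<a (m≤m+n a _))
... | above a<r rewrite high-∷-> w a<r | evalW-high a w w≢a m = s-shift a<r _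

module Inflation {a b : ℕ} (α : Fin a → Fin a) (β : Fin b → Fin b) where

  π : Fin (a + b) → Fin (a + b)
  π = inflate α β

  π-↑ˡ : ∀ j → toℕ (π (j ↑ˡ b)) ≡ toℕ (α j)
  π-↑ˡ j rewrite splitAt-↑ˡ a j b = toℕ-↑ˡ (α j) b

  π-↑ʳ : ∀ j → toℕ (π (a ↑ʳ j)) ≡ a + toℕ (β j)
  π-↑ʳ j rewrite splitAt-↑ʳ a b j = toℕ-↑ʳ a (β j)

  represents-π : ∀ h → Represents h α → (∀ j → h (a + toℕ j) ≡ a + toℕ (β j)) → Represents h π
  represents-π h h≈α h≈β i with ↑ˡ-or-↑ʳ a b i
  ... | inj₁ (j , refl) rewrite toℕ-↑ˡ j b = trans (h≈α j) (sym (π-↑ˡ j))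
  ... | inj₂ (j , refl) rewrite toℕ-↑ʳ a j = trans (h≈β j) (sym (π-↑ʳ j))

  represents-α : ∀ h → Represents h π → Represents h α
  represents-α h h≈π j = trans (cong h (sym (toℕ-↑ˡ j b))) (trans (h≈π (j ↑ˡ b)) (π-↑ˡ j))

  represents-β : ∀ h → Represents h π → ∀ j → h (a + toℕ j) ≡ a + toℕ (β j)
  represents-β h h≈π j = trans (cong h (sym (toℕ-↑ʳ a j))) (trans (h≈π (a ↑ʳ j)) (π-↑ʳ j))

  no-crossing-inversions : ∀ h → Represents h π → crossInversions a (a + b) h ≡ 0
  no-crossing-inversions h h≈π = sum<-zero (a + b) λ i _ → sum<-zero (a + b) λ j j<a+b → no-crossing-at i j j<a+b
    where
    no-crossing-at : ∀ i j → j < a + b → crossInversionAt a h i j ≡ 0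
    no-crossing-at i j j<a+b with i <ᵇ a in i<ᵇa | j <ᵇ a in j<ᵇa
    ... | false | _     = refl
    ... | true  | true  = refl
    ... | true  | false = trans (cong (λ t → boolToℕ ((i <ᵇ j) ∧ t)) (≥⇒<ᵇ-false (<⇒≤ (<-≤-trans hi<a a≤hj))))
                                (cong boolToℕ (∧-zeroʳ (i <ᵇ j)))
      where
      i<a = <ᵇ-true⇒< i<ᵇa
      a≤j = <ᵇ-false⇒≥ {j} {a} j<ᵇa
      j-a<b : j ∸ a < b
      j-a<b = +-cancelˡ-< a _ _ (subst (_< a + b) (sym (m+[n∸m]≡n a≤j)) j<a+b)
      hi<a : h i < a
      hi<a = subst (_< a) (sym (trans (cong h (sym (toℕ-fromℕ< i<a))) (represents-α h h≈π (fromℕ< i<a)))) (toℕ<n _)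
      a≤hj : a ≤ h j
      a≤hj = subst (a ≤_) (sym (trans (cong h (trans (sym (m+[n∸m]≡n a≤j)) (cong (a +_) (sym (toℕ-fromℕ< j-a<b)))))
                                       (represents-β h h≈π (fromℕ< j-a<b)))) (m≤m+n a _)

  represents-π-from-projections : ∀ w → All (_≢ a) w → Represents (evalW (low a w)) α
    → Represents (evalW (high a w)) β → Represents (evalW w) π
  represents-π-from-projections w w≢a low≈α high≈β = represents-π (evalW w)
    (λ j → trans (evalW-low a w w≢a (toℕ<n j)) (low≈α j))
    (λ j → trans (evalW-high a w w≢a (toℕ j)) (cong (a +_) (high≈β j)))

  represents-projections : ∀ w → All (_≢ a) w → Represents (evalW w) π
    → Represents (evalW (low a w)) α × Represents (evalW (high a w)) β
  represents-projections w w≢a w≈π =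
    (λ j → trans (sym (evalW-low a w w≢a (toℕ<n j))) (represents-α (evalW w) w≈π j)) ,
    (λ j → +-cancelˡ-≡ a _ _ (trans (sym (evalW-high a w w≢a (toℕ j))) (represents-β (evalW w) w≈π j)))

  module _ {x y} (rx : Reduced α x) (ry : Reduced β y) where

    private
      x<a : All (_< a) x
      x<a = All.map proj₂ (proj₁ rx)
      1≤y : All (1 ≤_) y
      1≤y = All.map proj₁ (proj₁ ry)

    low-x++y : low a (x ++ shift a y) ≡ x
    low-x++y = trans (low-++ a x (shift a y)) (trans (cong₂ _++_ (low-of-low x x<a) (low-shift a y)) (++-identityʳ x))

    high-x++y : high a (x ++ shift a y) ≡ y
    high-x++y = trans (high-++ a x (shift a y)) (cong₂ _++_ (high-of-low x x<a) (high-shift a y 1≤y))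

    low-y++x : low a (shift a y ++ x) ≡ x
    low-y++x = trans (low-++ a (shift a y) x) (cong₂ _++_ (low-shift a y) (low-of-low x x<a))

    high-y++x : high a (shift a y ++ x) ≡ y
    high-y++x = trans (high-++ a (shift a y) x) (trans (cong₂ _++_ (high-shift a y 1≤y) (high-of-low x x<a)) (++-identityʳ y))

    x-Letter : All (Letter (a + b)) x
    x-Letter = All.map (λ { (1≤r , r<a) → 1≤r , <-≤-trans r<a (m≤m+n a b) }) (proj₁ rx)

    x-avoids : All (_≢ a) x
    x-avoids = All.map (λ r<a r≡a → <-irrefl r≡a r<a) x<a

    shift-y-Letter : All (Letter (a + b)) (shift a y)
    shift-y-Letter = map⁺ (All.map (λ { {r} (1≤r , r<b) → ≤-trans 1≤r (m≤n+m r a) , +-monoʳ-< a r<b }) (proj₁ ry))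

    shift-y-avoids : All (_≢ a) (shift a y)
    shift-y-avoids = map⁺ (All.map (λ {r} 1≤r a+r≡a → <-irrefl (sym a+r≡a) (a<a+r 1≤r)) 1≤y)
      where
      a<a+r : ∀ {r} → 1 ≤ r → a < a + r
      a<a+r {r} 1≤r = subst (_< a + r) (+-identityʳ a) (+-monoʳ-< a 1≤r)

    len-π : len π ≡ len α + len β
    len-π = ≤-antisym (begin
      len π                         ≡⟨ len≡inversions π (evalW w) w≈π ⟩
      inversions (a + b) (evalW w)  ≤⟨ inversions-≤-length w (++⁺ x-Letter shift-y-Letter) ⟩
      length w                      ≡⟨ length-++ x ⟩
      length x + length (shift a y) ≡⟨ cong₂ _+_ (proj₁ (proj₂ rx)) (trans (length-map (a +_) y) (proj₁ (proj₂ ry))) ⟩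
      len α + len β                 ∎) (begin
      len α + len β                               ≡⟨ cong₂ _+_ (len≡inversions α (evalW x) (proj₂ (proj₂ rx)))
                                                                (len≡inversions β (evalW y) (proj₂ (proj₂ ry))) ⟩
      inversions a (evalW x) + inversions b (evalW y) ≤⟨ inversions-+ a b
          (λ i i<a → trans (evalW-low a w w≢a i<a) (cong (λ v → evalW v i) low-x++y))
          (λ i _ → trans (evalW-high a w w≢a i) (cong (λ v → a + evalW v i) high-x++y)) ⟩
      inversions (a + b) (evalW w)                ≡⟨ len≡inversions π (evalW w) w≈π ⟨
      len π                                       ∎)
      where
      open ≤-Reasoning
      w = x ++ shift a y
      w≢a = ++⁺ x-avoids shift-y-avoids
      w≈π : Represents (evalW w) π
      w≈π = represents-π-from-projections w w≢a
        (subst (λ v → Represents (evalW v) α) (sym low-x++y) (proj₂ (proj₂ rx)))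
        (subst (λ v → Represents (evalW v) β) (sym high-x++y) (proj₂ (proj₂ ry)))

  module _ (len-π≡ : len π ≡ len α + len β) where

    reduced-projections : ∀ {w} → Reduced π w → All (_≢ a) w × Reduced α (low a w) × Reduced β (high a w)
    reduced-projections {w} (w-Letter , length≡ , w≈π) =
      w≢a , (low-Letter a w w-Letter , low≡ , low≈α) , (high-Letter a w (All.map proj₂ w-Letter) , high≡ , high≈β)
      where
      w≢a : All (_≢ a) w
      w≢a = reduced-avoids-split a w w-Letter (trans (sym (len≡inversions π (evalW w) w≈π)) (sym length≡))
                                 (no-crossing-inversions (evalW w) w≈π)
      low≈α = proj₁ (represents-projections w w≢a w≈π)
      high≈β = proj₂ (represents-projections w w≢a w≈π)
      len-α≤ : len α ≤ length (low a w)
      len-α≤ = ≤-trans (≤-reflexive (len≡inversions α (evalW (low a w)) low≈α))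
                       (inversions-≤-length (low a w) (low-Letter a w w-Letter))
      len-β≤ : len β ≤ length (high a w)
      len-β≤ = ≤-trans (≤-reflexive (len≡inversions β (evalW (high a w)) high≈β))
                       (inversions-≤-length (high a w) (high-Letter a w (All.map proj₂ w-Letter)))
      lengths : length (low a w) + length (high a w) ≡ len α + len β
      lengths = trans (length-low+high a w w≢a) (trans length≡ len-π≡)
      low≡ : length (low a w) ≡ len α
      low≡ = ≤-antisym (+-cancelʳ-≤ _ _ _ (≤-trans (≤-reflexive lengths) (+-monoʳ-≤ (len α) len-β≤))) len-α≤
      high≡ : length (high a w) ≡ len β
      high≡ = +-cancelˡ-≡ (len α) _ _ (trans (cong (_+ length (high a w)) (sym low≡)) lengths)

    reduced-from-projections : ∀ {w} → All (Letter (a + b)) w → All (_≢ a) w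
      → Reduced α (low a w) → Reduced β (high a w) → Reduced π w
    reduced-from-projections {w} w-Letter w≢a (_ , low≡ , low≈α) (_ , high≡ , high≈β) =
      w-Letter ,
      trans (sym (length-low+high a w w≢a)) (trans (cong₂ _+_ low≡ high≡) (sym len-π≡)) ,
      represents-π-from-projections w w≢a low≈α high≈β

    module _ {x y} (rx : Reduced α x) (ry : Reduced β y) where

      reduced-x++y : Reduced π (x ++ shift a y)
      reduced-x++y = reduced-from-projections (++⁺ (x-Letter rx ry) (shift-y-Letter rx ry))
        (++⁺ (x-avoids rx ry) (shift-y-avoids rx ry))
        (subst (Reduced α) (sym (low-x++y rx ry)) rx) (subst (Reduced β) (sym (high-x++y rx ry)) ry)

      reduced-y++x : Reduced π (shift a y ++ x)
      reduced-y++x = reduced-from-projections (++⁺ (shift-y-Letter rx ry) (x-Letter rx ry))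
        (++⁺ (shift-y-avoids rx ry) (x-avoids rx ry))
        (subst (Reduced α) (sym (low-y++x rx ry)) rx) (subst (Reduced β) (sym (high-y++x rx ry)) ry)

-- Sorting a word by commutations

#true #false : List Bool → ℕ
#true []           = 0
#true (true ∷ bs)  = suc (#true bs)
#true (false ∷ bs) = #true bs
#false []           = 0
#false (true ∷ bs)  = #false bs
#false (false ∷ bs) = suc (#false bs)

inversionsᵇ : List Bool → ℕ
inversionsᵇ []           = 0
inversionsᵇ (true ∷ bs)  = #false bs + inversionsᵇ bs
inversionsᵇ (false ∷ bs) = inversionsᵇ bs

#false-++ : ∀ xs ys → #false (xs ++ ys) ≡ #false xs + #false ys
#false-++ []           ys = refl
#false-++ (true ∷ xs)  ys = #false-++ xs ys
#false-++ (false ∷ xs) ys = cong suc (#false-++ xs ys)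

inversionsᵇ-++ : ∀ xs ys → inversionsᵇ (xs ++ ys) ≡ inversionsᵇ xs + #true xs * #false ys + inversionsᵇ ys
inversionsᵇ-++ []           ys = refl
inversionsᵇ-++ (false ∷ xs) ys = inversionsᵇ-++ xs ys
inversionsᵇ-++ (true ∷ xs)  ys rewrite #false-++ xs ys | inversionsᵇ-++ xs ys =
  solve 5 (λ f f' i t i' → f :+ f' :+ (i :+ t :+ i') := f :+ i :+ (f' :+ t) :+ i') refl
          (#false xs) (#false ys) (inversionsᵇ xs) (#true xs * #false ys) (inversionsᵇ ys)
  where open +-*-Solver

inversionsᵇ-swap : ∀ xs ys → inversionsᵇ (xs ++ true ∷ false ∷ ys) ≡ suc (inversionsᵇ (xs ++ false ∷ true ∷ ys))
inversionsᵇ-swap xs ys rewrite inversionsᵇ-++ xs (true ∷ false ∷ ys) | inversionsᵇ-++ xs (false ∷ true ∷ ys) = +-suc _ _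

#false-map-not : ∀ bs → #false (map not bs) ≡ #true bs
#false-map-not []           = refl
#false-map-not (true ∷ bs)  = cong suc (#false-map-not bs)
#false-map-not (false ∷ bs) = #false-map-not bs

inversionsᵇ-complement : ∀ bs → inversionsᵇ bs + inversionsᵇ (map not bs) ≡ #true bs * #false bs
inversionsᵇ-complement []           = refl
inversionsᵇ-complement (true ∷ bs)  = trans (+-assoc (#false bs) _ _) (cong (#false bs +_) (inversionsᵇ-complement bs))
inversionsᵇ-complement (false ∷ bs) rewrite #false-map-not bs | *-suc (#true bs) (#false bs) = begin
  inversionsᵇ bs + (#true bs + inversionsᵇ (map not bs)) ≡⟨ +-assoc (inversionsᵇ bs) _ _ ⟨
  inversionsᵇ bs + #true bs + inversionsᵇ (map not bs)   ≡⟨ cong (_+ inversionsᵇ (map not bs)) (+-comm (inversionsᵇ bs) _) ⟩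
  #true bs + inversionsᵇ bs + inversionsᵇ (map not bs)   ≡⟨ +-assoc (#true bs) _ _ ⟩
  #true bs + (inversionsᵇ bs + inversionsᵇ (map not bs)) ≡⟨ cong (#true bs +_) (inversionsᵇ-complement bs) ⟩
  #true bs + #true bs * #false bs                        ∎
  where open ≡-Reasoning

disorder : (ℕ → Bool) → Word → ℕ
disorder cl w = inversionsᵇ (map cl w)

sorted : (ℕ → Bool) → Word → Word
sorted cl w = filterᵇ (not ∘ cl) w ++ filterᵇ cl w

filterᵇ-accept : ∀ (p : ℕ → Bool) r w → p r ≡ true → filterᵇ p (r ∷ w) ≡ r ∷ filterᵇ p w
filterᵇ-accept p r w p-r = filter-accept (λ x → T? (p x)) (subst T (sym p-r) tt)

filterᵇ-reject : ∀ (p : ℕ → Bool) r w → p r ≡ false → filterᵇ p (r ∷ w) ≡ filterᵇ p w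
filterᵇ-reject p r w p-r = filter-reject (λ x → T? (p x)) (subst T p-r)

filterᵇ-swap : ∀ (p : ℕ → Bool) u v {j k} → p j ≡ true → p k ≡ false
  → filterᵇ p (u ++ j ∷ k ∷ v) ≡ filterᵇ p (u ++ k ∷ j ∷ v)
filterᵇ-swap p u v {j} {k} p-j p-k = begin
  filterᵇ p (u ++ j ∷ k ∷ v)           ≡⟨ filter-++ (λ x → T? (p x)) u (j ∷ k ∷ v) ⟩
  filterᵇ p u ++ filterᵇ p (j ∷ k ∷ v) ≡⟨ cong (filterᵇ p u ++_) (trans (filterᵇ-accept p j (k ∷ v) p-j)
                                                                          (cong (j ∷_) (filterᵇ-reject p k v p-k))) ⟩
  filterᵇ p u ++ j ∷ filterᵇ p v       ≡⟨ cong (filterᵇ p u ++_) (trans (filterᵇ-reject p k (j ∷ v) p-k)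
                                                                          (filterᵇ-accept p j v p-j)) ⟨
  filterᵇ p u ++ filterᵇ p (k ∷ j ∷ v) ≡⟨ filter-++ (λ x → T? (p x)) u (k ∷ j ∷ v) ⟨
  filterᵇ p (u ++ k ∷ j ∷ v)           ∎
  where open ≡-Reasoning

module _ (cl : ℕ → Bool) {j k : ℕ} (cl-j : cl j ≡ true) (cl-k : cl k ≡ false) (u v : Word) where

  disorder-swap : disorder cl (u ++ j ∷ k ∷ v) ≡ suc (disorder cl (u ++ k ∷ j ∷ v))
  disorder-swap rewrite map-++ cl u (j ∷ k ∷ v) | map-++ cl u (k ∷ j ∷ v) | cl-j | cl-k =
    inversionsᵇ-swap (map cl u) (map cl v)

  sorted-swap : sorted cl (u ++ j ∷ k ∷ v) ≡ sorted cl (u ++ k ∷ j ∷ v)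
  sorted-swap = cong₂ _++_ (sym (filterᵇ-swap (not ∘ cl) u v (cong not cl-k) (cong not cl-j)))
                           (filterᵇ-swap cl u v cl-j cl-k)

bool-cases : ∀ b → b ≡ true ⊎ b ≡ false
bool-cases true  = inj₁ refl
bool-cases false = inj₂ refl

module _ (cl : ℕ → Bool) where

  all-true-sorted : ∀ w → #false (map cl w) ≡ 0 → filterᵇ (not ∘ cl) w ≡ [] × filterᵇ cl w ≡ w
  all-true-sorted []      _      = refl , refl
  all-true-sorted (r ∷ w) #f≡0 with bool-cases (cl r)
  ... | inj₁ cl-r = trans (filterᵇ-reject (not ∘ cl) r w (cong not cl-r)) (proj₁ rest) ,
                    trans (filterᵇ-accept cl r w cl-r) (cong (r ∷_) (proj₂ rest))
    where rest = all-true-sorted w (subst (λ b → #false (b ∷ map cl w) ≡ 0) cl-r #f≡0)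
  ... | inj₂ cl-r = ⊥-elim (1+n≢0 (subst (λ b → #false (b ∷ map cl w) ≡ 0) cl-r #f≡0))

  disorder≡0⇒sorted : ∀ w → disorder cl w ≡ 0 → w ≡ sorted cl w
  disorder≡0⇒sorted []      _   = refl
  disorder≡0⇒sorted (r ∷ w) d≡0 with bool-cases (cl r)
  ... | inj₁ cl-r = begin
    r ∷ w                                      ≡⟨ cong (r ∷_) (proj₂ all-true) ⟨
    r ∷ filterᵇ cl w                           ≡⟨ cong (_++ r ∷ filterᵇ cl w) (proj₁ all-true) ⟨
    filterᵇ (not ∘ cl) w ++ r ∷ filterᵇ cl w   ≡⟨ cong₂ _++_ (filterᵇ-reject (not ∘ cl) r w (cong not cl-r))
                                                             (filterᵇ-accept cl r w cl-r) ⟨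
    sorted cl (r ∷ w)                          ∎
    where
    open ≡-Reasoning
    all-true = all-true-sorted w (m+n≡0⇒m≡0 _ (subst (λ b → inversionsᵇ (b ∷ map cl w) ≡ 0) cl-r d≡0))
  ... | inj₂ cl-r = begin
    r ∷ w                                      ≡⟨ cong (r ∷_) (disorder≡0⇒sorted w (subst (λ b → inversionsᵇ (b ∷ map cl w) ≡ 0)
                                                                                        cl-r d≡0)) ⟩
    r ∷ sorted cl w                            ≡⟨ cong₂ _++_ (filterᵇ-accept (not ∘ cl) r w (cong not cl-r))
                                                             (filterᵇ-reject cl r w cl-r) ⟨
    sorted cl (r ∷ w)                          ∎
    where open ≡-Reasoning

record AdjacentDescent (cl : ℕ → Bool) (w : Word) : Set where
  field
    u v   : Word
    j k   : ℕ
    split : w ≡ u ++ j ∷ k ∷ v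
    cl-j  : cl j ≡ true
    cl-k  : cl k ≡ false

descent-∷ : ∀ {cl w} r → AdjacentDescent cl w → AdjacentDescent cl (r ∷ w)
descent-∷ r d = record { AdjacentDescent d ; u = r ∷ AdjacentDescent.u d ; split = cong (r ∷_) (AdjacentDescent.split d) }

adjacentDescent : ∀ cl w → 0 < disorder cl w → AdjacentDescent cl w
adjacentDescent cl (r ∷ w) pos with cl r in cl-r
... | false = descent-∷ r (adjacentDescent cl w pos)
... | true  = after-true r cl-r w pos
  where
  after-true : ∀ r → cl r ≡ true → ∀ w → 0 < #false (map cl w) + disorder cl w → AdjacentDescent cl (r ∷ w)
  after-true r cl-r (r' ∷ w) pos with cl r' in cl-r'
  ... | false = record { u = [] ; v = w ; j = r ; k = r' ; split = refl ; cl-j = cl-r ; cl-k = cl-r' }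
  ... | true  = descent-∷ r (after-true r' cl-r' w (halve (#false (map cl w)) pos))
    where
    halve : ∀ m {n} → 0 < m + (m + n) → 0 < m + n
    halve zero    pos = pos
    halve (suc m) _   = z<s

data Chain (E : Word → Word → Set) : ℕ → Word → Word → Set where
  []  : ∀ {w} → Chain E 0 w w
  _∷_ : ∀ {k w z y} → E w z → Chain E k z y → Chain E (suc k) w y

Chain-++ : ∀ {E k m x y z} → Chain E k x y → Chain E m y z → Chain E (k + m) x z
Chain-++ []       q = q
Chain-++ (e ∷ p) q = e ∷ Chain-++ p q

Chain-reverse : ∀ {E k x y} → (∀ {w z} → E w z → E z w) → Chain E k x y → Chain E k y x
Chain-reverse E-sym []                    = []
Chain-reverse {E} {suc k} {x} {y} E-sym (e ∷ p) =
  subst (λ n → Chain E n y x) (+-comm k 1) (Chain-++ (Chain-reverse E-sym p) (E-sym e ∷ []))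

-- By induction on the disorder: swapping an adjacent (true , false) pair lowers it by one.
sortingChain : ∀ (cl : ℕ → Bool) {R : Word → Set} {E : Word → Word → Set}
  → (∀ {u j k v} → R (u ++ j ∷ k ∷ v) → cl j ≡ true → cl k ≡ false
       → E (u ++ j ∷ k ∷ v) (u ++ k ∷ j ∷ v) × R (u ++ k ∷ j ∷ v))
  → ∀ {w} → R w → Chain E (disorder cl w) w (sorted cl w)
sortingChain cl {R} {E} swap {w} Rw = go (disorder cl w) w refl Rw
  where
  go : ∀ n w → disorder cl w ≡ n → R w → Chain E n w (sorted cl w)
  go zero    w d≡0 _  = subst (Chain E 0 w) (disorder≡0⇒sorted cl w d≡0) []
  go (suc n) w d≡1+n Rw with adjacentDescent cl w (subst (0 <_) (sym d≡1+n) z<s)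
  ... | record { u = u ; v = v ; split = refl ; cl-j = cl-j ; cl-k = cl-k } =
    subst (Chain E (suc n) _) (sym (sorted-swap cl cl-j cl-k u v))
      (proj₁ (swap Rw cl-j cl-k)
         ∷ go n _ (suc-injective (trans (sym (disorder-swap cl cl-j cl-k u v)) d≡1+n)) (proj₂ (swap Rw cl-j cl-k)))

#true-map : ∀ (p : ℕ → Bool) w → #true (map p w) ≡ length (filterᵇ p w)
#true-map p []      = refl
#true-map p (r ∷ w) with bool-cases (p r)
... | inj₁ p-r rewrite p-r = cong suc (#true-map p w)
... | inj₂ p-r rewrite p-r = #true-map p w

#false-map : ∀ (p : ℕ → Bool) w → #false (map p w) ≡ length (filterᵇ (not ∘ p) w)
#false-map p []      = refl
#false-map p (r ∷ w) with bool-cases (p r)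
... | inj₁ p-r rewrite p-r = #false-map p w
... | inj₂ p-r rewrite p-r = cong suc (#false-map p w)

filterᵇ-cong : ∀ {p q : ℕ → Bool} w → All (λ r → p r ≡ q r) w → filterᵇ p w ≡ filterᵇ q w
filterᵇ-cong []      []           = refl
filterᵇ-cong {p} {q} (r ∷ w) (pr≡qr ∷ p≗q) with bool-cases (p r)
... | inj₁ p-r = trans (filterᵇ-accept p r w p-r)
                 (trans (cong (r ∷_) (filterᵇ-cong w p≗q)) (sym (filterᵇ-accept q r w (trans (sym pr≡qr) p-r))))
... | inj₂ p-r = trans (filterᵇ-reject p r w p-r)
                 (trans (filterᵇ-cong w p≗q) (sym (filterᵇ-reject q r w (trans (sym pr≡qr) p-r))))

module _ {A : Set} where

  #true-all-false : ∀ (xs : List A) → #true (map (λ _ → false) xs) ≡ 0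
  #true-all-false []       = refl
  #true-all-false (_ ∷ xs) = #true-all-false xs

  #true-all-true : ∀ (xs : List A) → #true (map (λ _ → true) xs) ≡ length xs
  #true-all-true []       = refl
  #true-all-true (_ ∷ xs) = cong suc (#true-all-true xs)

  #false-all-false : ∀ (xs : List A) → #false (map (λ _ → false) xs) ≡ length xs
  #false-all-false []       = refl
  #false-all-false (_ ∷ xs) = cong suc (#false-all-false xs)

  inversionsᵇ-all-false : ∀ (xs : List A) → inversionsᵇ (map (λ _ → false) xs) ≡ 0
  inversionsᵇ-all-false []       = refl
  inversionsᵇ-all-false (_ ∷ xs) = inversionsᵇ-all-false xs

  #false-all-true : ∀ (xs : List A) → #false (map (λ _ → true) xs) ≡ 0
  #false-all-true []       = refl
  #false-all-true (_ ∷ xs) = #false-all-true xs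

  inversionsᵇ-all-true : ∀ (xs : List A) → inversionsᵇ (map (λ _ → true) xs) ≡ 0
  inversionsᵇ-all-true []       = refl
  inversionsᵇ-all-true (_ ∷ xs) rewrite #false-all-true xs = inversionsᵇ-all-true xs

-- Moves and their projections

comm-sym : ∀ {w w'} → CommMove w w' → CommMove w' w
comm-sym (u , v , j , k , far , refl , refl) = u , v , k , j , [ inj₂ , inj₁ ]′ far , refl , refl

braid-sym : ∀ {w w'} → BraidMove w w' → BraidMove w' w
braid-sym (u , v , j , inj₁ (w≡ , w'≡)) = u , v , j , inj₂ (w'≡ , w≡)
braid-sym (u , v , j , inj₂ (w≡ , w'≡)) = u , v , j , inj₁ (w'≡ , w≡)

comm-++ˡ : ∀ p {w w'} → CommMove w w' → CommMove (p ++ w) (p ++ w')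
comm-++ˡ p (u , v , j , k , far , refl , refl) = p ++ u , v , j , k , far , sym (++-assoc p u _) , sym (++-assoc p u _)

comm-++ʳ : ∀ q {w w'} → CommMove w w' → CommMove (w ++ q) (w' ++ q)
comm-++ʳ q (u , v , j , k , far , refl , refl) = u , v ++ q , j , k , far , ++-assoc u _ q , ++-assoc u _ q

braid-++ˡ : ∀ p {w w'} → BraidMove w w' → BraidMove (p ++ w) (p ++ w')
braid-++ˡ p (u , v , j , inj₁ (refl , refl)) = p ++ u , v , j , inj₁ (sym (++-assoc p u _) , sym (++-assoc p u _))
braid-++ˡ p (u , v , j , inj₂ (refl , refl)) = p ++ u , v , j , inj₂ (sym (++-assoc p u _) , sym (++-assoc p u _))

braid-++ʳ : ∀ q {w w'} → BraidMove w w' → BraidMove (w ++ q) (w' ++ q)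
braid-++ʳ q (u , v , j , inj₁ (refl , refl)) = u , v ++ q , j , inj₁ (++-assoc u _ q , ++-assoc u _ q)
braid-++ʳ q (u , v , j , inj₂ (refl , refl)) = u , v ++ q , j , inj₂ (++-assoc u _ q , ++-assoc u _ q)

farApart-+ : ∀ a {j k} → FarApart j k → FarApart (a + j) (a + k)
farApart-+ a {j} {k} (inj₁ j+1<k) = inj₁ (subst (_< a + k) (+-suc a j) (+-monoʳ-< a j+1<k))
farApart-+ a {j} {k} (inj₂ k+1<j) = inj₂ (subst (_< a + j) (+-suc a k) (+-monoʳ-< a k+1<j))

farApart-∸ : ∀ {a j k} → a < j → a < k → FarApart j k → FarApart (j ∸ a) (k ∸ a)
farApart-∸ {a} {j} {k} a<j a<k (inj₁ j+1<k) =
  inj₁ (subst (_< k ∸ a) (+-∸-assoc 1 (<⇒≤ a<j)) (∸-monoˡ-< j+1<k (≤-trans (<⇒≤ a<j) (n≤1+n j))))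
farApart-∸ {a} {j} {k} a<j a<k (inj₂ k+1<j) =
  inj₂ (subst (_< j ∸ a) (+-∸-assoc 1 (<⇒≤ a<k)) (∸-monoˡ-< k+1<j (≤-trans (<⇒≤ a<k) (n≤1+n k))))

comm-shift : ∀ a {w w'} → CommMove w w' → CommMove (shift a w) (shift a w')
comm-shift a (u , v , j , k , far , refl , refl) =
  shift a u , shift a v , a + j , a + k , farApart-+ a far , map-++ (a +_) u _ , map-++ (a +_) u _

braid-shift : ∀ a {w w'} → BraidMove w w' → BraidMove (shift a w) (shift a w')
braid-shift a (u , v , j , moves) = shift a u , shift a v , a + j , shifted moves
  where
  x x' : Word
  x  = j ∷ suc j ∷ j ∷ []
  x' = suc j ∷ j ∷ suc j ∷ []
  shift-x : ∀ y → shift a (u ++ y ++ v) ≡ shift a u ++ shift a y ++ shift a v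
  shift-x y = trans (map-++ (a +_) u (y ++ v)) (cong (shift a u ++_) (map-++ (a +_) y v))
  x-shifted : shift a x ≡ (a + j) ∷ suc (a + j) ∷ (a + j) ∷ []
  x-shifted = cong (λ t → (a + j) ∷ t ∷ (a + j) ∷ []) (+-suc a j)
  x'-shifted : shift a x' ≡ suc (a + j) ∷ (a + j) ∷ suc (a + j) ∷ []
  x'-shifted = cong (λ t → t ∷ (a + j) ∷ t ∷ []) (+-suc a j)
  via : ∀ {y t} → shift a y ≡ t → shift a (u ++ y ++ v) ≡ shift a u ++ t ++ shift a v
  via {y} e = trans (shift-x y) (cong (λ t → shift a u ++ t ++ shift a v) e)
  shifted : _ → _
  shifted (inj₁ (refl , refl)) = inj₁ (via x-shifted , via x'-shifted)
  shifted (inj₂ (refl , refl)) = inj₂ (via x'-shifted , via x-shifted)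

comm-preserves-Reduced : ∀ {n} (f : Fin n → Fin n) {w w'} → Reduced f w → CommMove w w' → Reduced f w'
comm-preserves-Reduced f (letters , length≡ , w≈f) (u , v , j , k , far , refl , refl) =
  ++⁺ (++⁻ˡ u letters) (swap-first (++⁻ʳ u letters)) ,
  trans (length-++ u) (trans (sym (length-++ u)) length≡) ,
  λ i → begin
    evalW (u ++ k ∷ j ∷ v) (toℕ i)      ≡⟨ evalW-++ u (k ∷ j ∷ v) (toℕ i) ⟩
    evalW u (s k (s j (evalW v (toℕ i)))) ≡⟨ cong (evalW u) (s-comm far (evalW v (toℕ i))) ⟨
    evalW u (s j (s k (evalW v (toℕ i)))) ≡⟨ evalW-++ u (j ∷ k ∷ v) (toℕ i) ⟨
    evalW (u ++ j ∷ k ∷ v) (toℕ i)      ≡⟨ w≈f i ⟩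
    toℕ (f i)                             ∎
  where
  open ≡-Reasoning
  swap-first : ∀ {P : ℕ → Set} → All P (j ∷ k ∷ v) → All P (k ∷ j ∷ v)
  swap-first (pj ∷ pk ∷ pv) = pk ∷ pj ∷ pv

module Split (a : ℕ) where

  isHigh : ℕ → Bool
  isHigh = a <ᵇ_

  highLow : Word → ℕ
  highLow = disorder isHigh

  low-of-high : ∀ x → All (a <_) x → low a x ≡ []
  low-of-high []      []            = refl
  low-of-high (r ∷ x) (a<r ∷ a<x) = trans (low-∷-≥ x (<⇒≤ a<r)) (low-of-high x a<x)

  high-of-high : ∀ x → All (a <_) x → high a x ≡ map (_∸ a) x
  high-of-high []      []            = refl
  high-of-high (r ∷ x) (a<r ∷ a<x) = trans (high-∷-> x a<r) (cong ((r ∸ a) ∷_) (high-of-high x a<x))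

  isHigh-of-low : ∀ x → All (_< a) x → map isHigh x ≡ map (λ _ → false) x
  isHigh-of-low []      []            = refl
  isHigh-of-low (r ∷ x) (r<a ∷ x<a) = cong₂ _∷_ (≥⇒<ᵇ-false (<⇒≤ r<a)) (isHigh-of-low x x<a)

  isHigh-of-high : ∀ x → All (a <_) x → map isHigh x ≡ map (λ _ → true) x
  isHigh-of-high []      []            = refl
  isHigh-of-high (r ∷ x) (a<r ∷ a<x) = cong₂ _∷_ (<⇒<ᵇ-true a<r) (isHigh-of-high x a<x)

  infix-++ : ∀ {B : Set} (F : Word → List B) → (∀ u v → F (u ++ v) ≡ F u ++ F v)
    → ∀ u x v {y} → F x ≡ y → F (u ++ x ++ v) ≡ F u ++ y ++ F v
  infix-++ F F-++ u x v refl = trans (F-++ u (x ++ v)) (cong (F u ++_) (F-++ x v))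

  low-infix = infix-++ (low a) (low-++ a)
  high-infix = infix-++ (high a) (high-++ a)
  isHigh-infix = infix-++ (map isHigh) (map-++ isHigh)

  data CommKind (w z : Word) : Set where
    low-comm   : CommMove (low a w) (low a z) → high a w ≡ high a z → highLow w ≡ highLow z → CommKind w z
    high-comm  : low a w ≡ low a z → CommMove (high a w) (high a z) → highLow w ≡ highLow z → CommKind w z
    cross-comm : low a w ≡ low a z → high a w ≡ high a z → (highLow w ≡ suc (highLow z) ⊎ highLow z ≡ suc (highLow w))
               → CommKind w z

  data BraidKind (w z : Word) : Set where
    low-braid  : BraidMove (low a w) (low a z) → high a w ≡ high a z → highLow w ≡ highLow z → BraidKind w z
    high-braid : low a w ≡ low a z → BraidMove (high a w) (high a z) → highLow w ≡ highLow z → BraidKind w z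

  CommKind-sym : ∀ {w z} → CommKind w z → CommKind z w
  CommKind-sym (low-comm m h d)       = low-comm (comm-sym m) (sym h) (sym d)
  CommKind-sym (high-comm l m d)      = high-comm (sym l) (comm-sym m) (sym d)
  CommKind-sym (cross-comm l h d)     = cross-comm (sym l) (sym h) ([ inj₂ , inj₁ ]′ d)

  BraidKind-sym : ∀ {w z} → BraidKind w z → BraidKind z w
  BraidKind-sym (low-braid m h d)  = low-braid (braid-sym m) (sym h) (sym d)
  BraidKind-sym (high-braid l m d) = high-braid (sym l) (braid-sym m) (sym d)

  cross-comm-kind : ∀ u v {j k} → j < a → a < k → CommKind (u ++ j ∷ k ∷ v) (u ++ k ∷ j ∷ v)
  cross-comm-kind u v {j} {k} j<a a<k = cross-comm
    (trans (low-infix u (j ∷ k ∷ []) v low-jk) (sym (low-infix u (k ∷ j ∷ []) v low-kj)))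
    (trans (high-infix u (j ∷ k ∷ []) v high-jk) (sym (high-infix u (k ∷ j ∷ []) v high-kj)))
    (inj₂ (disorder-swap isHigh (<⇒<ᵇ-true a<k) (≥⇒<ᵇ-false (<⇒≤ j<a)) u v))
    where
    low-jk  = trans (low-∷-< _ j<a) (cong (j ∷_) (low-∷-≥ [] (<⇒≤ a<k)))
    low-kj  = trans (low-∷-≥ _ (<⇒≤ a<k)) (low-∷-< [] j<a)
    high-jk = trans (high-∷-≤ _ (<⇒≤ j<a)) (high-∷-> [] a<k)
    high-kj = trans (high-∷-> _ a<k) (cong ((k ∸ a) ∷_) (high-∷-≤ [] (<⇒≤ j<a)))

  commKind : ∀ {w z} → All (_≢ a) w → CommMove w z → CommKind w z
  commKind w≢a (u , v , j , k , far , refl , refl) with ++⁻ʳ u w≢a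
  ... | j≢a ∷ k≢a ∷ _ with side j≢a | side k≢a
  ... | below j<a | below k<a = low-comm
    (low a u , low a v , j , k , far , low-infix u (j ∷ k ∷ []) v (low-of-low _ jk<a) ,
                                       low-infix u (k ∷ j ∷ []) v (low-of-low _ kj<a))
    (trans (high-infix u (j ∷ k ∷ []) v (high-of-low _ jk<a)) (sym (high-infix u (k ∷ j ∷ []) v (high-of-low _ kj<a))))
    (cong inversionsᵇ (trans (isHigh-infix u (j ∷ k ∷ []) v (isHigh-of-low _ jk<a))
                             (sym (isHigh-infix u (k ∷ j ∷ []) v (isHigh-of-low _ kj<a)))))
    where
    jk<a = j<a ∷ k<a ∷ []
    kj<a = k<a ∷ j<a ∷ []
  ... | above a<j | above a<k = high-comm
    (trans (low-infix u (j ∷ k ∷ []) v (low-of-high _ a<jk)) (sym (low-infix u (k ∷ j ∷ []) v (low-of-high _ a<kj))))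
    (high a u , high a v , j ∸ a , k ∸ a , farApart-∸ a<j a<k far ,
       high-infix u (j ∷ k ∷ []) v (high-of-high _ a<jk) , high-infix u (k ∷ j ∷ []) v (high-of-high _ a<kj))
    (cong inversionsᵇ (trans (isHigh-infix u (j ∷ k ∷ []) v (isHigh-of-high _ a<jk))
                             (sym (isHigh-infix u (k ∷ j ∷ []) v (isHigh-of-high _ a<kj)))))
    where
    a<jk = a<j ∷ a<k ∷ []
    a<kj = a<k ∷ a<j ∷ []
  ... | below j<a | above a<k = cross-comm-kind u v j<a a<k
  ... | above a<j | below k<a = CommKind-sym (cross-comm-kind u v k<a a<j)

  braid-kind : ∀ u v {j} → j ≢ a → suc j ≢ a → BraidKind (u ++ j ∷ suc j ∷ j ∷ v) (u ++ suc j ∷ j ∷ suc j ∷ v)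
  braid-kind u v {j} j≢a j+1≢a with side j≢a
  ... | below j<a = low-braid
    (low a u , low a v , j , inj₁ (low-infix u x v (low-of-low x x<a) , low-infix u x' v (low-of-low x' x'<a)))
    (trans (high-infix u x v (high-of-low x x<a)) (sym (high-infix u x' v (high-of-low x' x'<a))))
    (cong inversionsᵇ (trans (isHigh-infix u x v (isHigh-of-low x x<a)) (sym (isHigh-infix u x' v (isHigh-of-low x' x'<a)))))
    where
    x  = j ∷ suc j ∷ j ∷ []
    x' = suc j ∷ j ∷ suc j ∷ []
    j+1<a = ≤∧≢⇒< j<a j+1≢a
    x<a  = j<a ∷ j+1<a ∷ j<a ∷ []
    x'<a = j+1<a ∷ j<a ∷ j+1<a ∷ []
  ... | above a<j = high-braid
    (trans (low-infix u x v (low-of-high x a<x)) (sym (low-infix u x' v (low-of-high x' a<x'))))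
    (high a u , high a v , j ∸ a , inj₁
      ( high-infix u x v (trans (high-of-high x a<x) (cong (λ t → (j ∸ a) ∷ t ∷ (j ∸ a) ∷ []) j+1∸a))
      , high-infix u x' v (trans (high-of-high x' a<x') (cong (λ t → t ∷ (j ∸ a) ∷ t ∷ []) j+1∸a))))
    (cong inversionsᵇ (trans (isHigh-infix u x v (isHigh-of-high x a<x)) (sym (isHigh-infix u x' v (isHigh-of-high x' a<x')))))
    where
    x  = j ∷ suc j ∷ j ∷ []
    x' = suc j ∷ j ∷ suc j ∷ []
    a<j+1 = <-trans a<j (n<1+n j)
    a<x  = a<j ∷ a<j+1 ∷ a<j ∷ []
    a<x' = a<j+1 ∷ a<j ∷ a<j+1 ∷ []
    j+1∸a : suc j ∸ a ≡ suc (j ∸ a)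
    j+1∸a = +-∸-assoc 1 (<⇒≤ a<j)

  braidKind : ∀ {w z} → All (_≢ a) w → BraidMove w z → BraidKind w z
  braidKind w≢a (u , v , j , inj₁ (refl , refl)) with ++⁻ʳ u w≢a
  ... | j≢a ∷ j+1≢a ∷ _ = braid-kind u v j≢a j+1≢a
  braidKind w≢a (u , v , j , inj₂ (refl , refl)) with ++⁻ʳ u w≢a
  ... | j+1≢a ∷ j≢a ∷ _ = BraidKind-sym (braid-kind u v j≢a j+1≢a)

  isLow : ℕ → Bool
  isLow = _<ᵇ a

  not-isHigh : ∀ {r} → r ≢ a → not (isHigh r) ≡ isLow r
  not-isHigh r≢a with side r≢a
  ... | below r<a rewrite ≥⇒<ᵇ-false (<⇒≤ r<a) | <⇒<ᵇ-true r<a = refl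
  ... | above a<r rewrite <⇒<ᵇ-true a<r | ≥⇒<ᵇ-false (<⇒≤ a<r) = refl

  not-isLow : ∀ {r} → r ≢ a → not (isLow r) ≡ isHigh r
  not-isLow r≢a with side r≢a
  ... | below r<a rewrite ≥⇒<ᵇ-false (<⇒≤ r<a) | <⇒<ᵇ-true r<a = refl
  ... | above a<r rewrite <⇒<ᵇ-true a<r | ≥⇒<ᵇ-false (<⇒≤ a<r) = refl

  shift-high : ∀ w → shift a (high a w) ≡ filterᵇ isHigh w
  shift-high []      = refl
  shift-high (r ∷ w) with bool-cases (isHigh r)
  ... | inj₁ hi rewrite hi = cong₂ _∷_ (m+[n∸m]≡n (<⇒≤ (<ᵇ-true⇒< hi))) (shift-high w)
  ... | inj₂ lo rewrite lo = shift-high w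

  sorted-isHigh : ∀ w → All (_≢ a) w → sorted isHigh w ≡ low a w ++ shift a (high a w)
  sorted-isHigh w w≢a = cong₂ _++_ (filterᵇ-cong w (All.map not-isHigh w≢a)) (sym (shift-high w))

  sorted-isLow : ∀ w → All (_≢ a) w → sorted isLow w ≡ shift a (high a w) ++ low a w
  sorted-isLow w w≢a = cong (_++ low a w) (trans (filterᵇ-cong w (All.map not-isLow w≢a)) (sym (shift-high w)))

  highLow+lowHigh : ∀ w → All (_≢ a) w → highLow w + disorder isLow w ≡ length (high a w) * length (low a w)
  highLow+lowHigh w w≢a = begin
    highLow w + disorder isLow w                          ≡⟨ cong (λ bs → highLow w + inversionsᵇ bs) isLow≡not-isHigh ⟩
    highLow w + inversionsᵇ (map not (map isHigh w))     ≡⟨ inversionsᵇ-complement (map isHigh w) ⟩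
    #true (map isHigh w) * #false (map isHigh w)          ≡⟨ cong₂ _*_ #high #low ⟩
    length (high a w) * length (low a w)                  ∎
    where
    open ≡-Reasoning
    isLow≡not-isHigh : map isLow w ≡ map not (map isHigh w)
    isLow≡not-isHigh = trans (map-cong-All w (All.map (sym ∘ not-isHigh) w≢a)) (map-∘ w)
      where
      map-cong-All : ∀ {f g : ℕ → Bool} w → All (λ r → f r ≡ g r) w → map f w ≡ map g w
      map-cong-All []      []           = refl
      map-cong-All (r ∷ w) (fr≡gr ∷ f≗g) = cong₂ _∷_ fr≡gr (map-cong-All w f≗g)
    #high : #true (map isHigh w) ≡ length (high a w)
    #high = trans (#true-map isHigh w) (sym (length-map (_∸ a) (filterᵇ isHigh w)))
    #low : #false (map isHigh w) ≡ length (low a w)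
    #low = trans (#false-map isHigh w) (cong length (filterᵇ-cong w (All.map not-isHigh w≢a)))

  highLow-sorted : ∀ {x z} → All (_< a) x → All (a <_) z → highLow (x ++ z) ≡ 0
  highLow-sorted {x} {z} x<a a<z rewrite map-++ isHigh x z | isHigh-of-low x x<a | isHigh-of-high z a<z
    | inversionsᵇ-++ (map (λ _ → false) x) (map (λ _ → true) z)
    | inversionsᵇ-all-false x | #true-all-false x | inversionsᵇ-all-true z = refl

  highLow-reversed : ∀ {x z} → All (_< a) x → All (a <_) z → highLow (z ++ x) ≡ length z * length x
  highLow-reversed {x} {z} x<a a<z rewrite map-++ isHigh z x | isHigh-of-low x x<a | isHigh-of-high z a<z
    | inversionsᵇ-++ (map (λ _ → true) z) (map (λ _ → false) x)
    | inversionsᵇ-all-false x | #true-all-true z | inversionsᵇ-all-true z | #false-all-false x = +-identityʳ _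

-- Walks

≡-Same : ∀ {A} (G : SGraph A) {x x' y} → x ≡ x' → Same G x' y → Same G x y
≡-Same G refl s = s

Same-sym : ∀ {A : Set} {V : A → Set} {F E : A → A → Set} → (∀ {x y} → F x y → F y x)
  → ∀ {x y} → Same (contract V F E) x y → Same (contract V F E) y x
Same-sym F-sym = Star.reverse λ { (Vx , Vy , Fxy) → Vy , Vx , F-sym Fxy }

module _ {A : Set} {V : A → Set} {F E : A → A → Set} where

  private
    K = contract V F E

  Same-◅ : ∀ {k x x' y} → Same K x x' → Walk K k x' y → Walk K k x y
  Same-◅ s (here s')                              = here (s ◅◅ s')
  Same-◅ s (step (x'' , y' , s₁ , s₂ , Vx'' , Vy' , e) p) = step (x'' , y' , s ◅◅ s₁ , s₂ , Vx'' , Vy' , e) p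

  ▻-Same : ∀ {k x y y'} → Walk K k x y → Same K y y' → Walk K k x y'
  ▻-Same (here s)   s' = here (s ◅◅ s')
  ▻-Same (step e p) s' = step e (▻-Same p s')

  contract-++ : ∀ {k m x y z} → Walk K k x y → Walk K m y z → Walk K (k + m) x z
  contract-++ (here s)   q = Same-◅ s q
  contract-++ (step e p) q = step e (contract-++ p q)

plain-++ : ∀ {A : Set} {V : A → Set} {E : A → A → Set} {k m x y z}
  → Walk (plain V E) k x y → Walk (plain V E) m y z → Walk (plain V E) (k + m) x z
plain-++ (here refl) q = q
plain-++ (step e p)  q = step e (plain-++ p q)

module _ {A B : Set} {V : A → Set} {F E : A → A → Set} {V' : B → Set} {F' E' : B → B → Set} (φ : A → B)
         (φ-V : ∀ {x} → V x → V' (φ x)) (φ-F : ∀ {x y} → F x y → F' (φ x) (φ y))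
         (φ-E : ∀ {x y} → E x y → E' (φ x) (φ y)) where

  contract-map-Same : ∀ {x y} → Same (contract V F E) x y → Same (contract V' F' E') (φ x) (φ y)
  contract-map-Same = gmap φ λ { (Vx , Vy , Fxy) → φ-V Vx , φ-V Vy , φ-F Fxy }

  contract-map : ∀ {k x y} → Walk (contract V F E) k x y → Walk (contract V' F' E') k (φ x) (φ y)
  contract-map (here s) = here (contract-map-Same s)
  contract-map (step (x' , y' , s₁ , s₂ , Vx' , Vy' , e) p) =
    step (φ x' , φ y' , contract-map-Same s₁ , contract-map-Same s₂ , φ-V Vx' , φ-V Vy' , φ-E e) (contract-map p)

record IsEmbedding {m n} (f : Fin m → Fin m) (g : Fin n → Fin n) (φ : Word → Word) : Set where
  field
    comm    : ∀ {w w'} → CommMove w w' → CommMove (φ w) (φ w')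
    braid   : ∀ {w w'} → BraidMove w w' → BraidMove (φ w) (φ w')
    reduced : ∀ {w} → Reduced f w → Reduced g (φ w)

  commEdge : ∀ {w w'} → CommEdge f w w' → CommEdge g (φ w) (φ w')
  commEdge (rw , rw' , m) = reduced rw , reduced rw' , comm m

  braidEdge : ∀ {w w'} → BraidEdge f w w' → BraidEdge g (φ w) (φ w')
  braidEdge (rw , rw' , m) = reduced rw , reduced rw' , braid m

  embed-Gr : ∀ {k x y} → Walk (Gr f) k x y → Walk (Gr g) k (φ x) (φ y)
  embed-Gr (here refl)       = here refl
  embed-Gr (step (inj₁ e) p) = step (inj₁ (commEdge e)) (embed-Gr p)
  embed-Gr (step (inj₂ e) p) = step (inj₂ (braidEdge e)) (embed-Gr p)

  embed-Cgr : ∀ {k x y} → Walk (Cgr f) k x y → Walk (Cgr g) k (φ x) (φ y)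
  embed-Cgr = contract-map φ reduced commEdge braidEdge

  embed-Bgr : ∀ {k x y} → Walk (Bgr f) k x y → Walk (Bgr g) k (φ x) (φ y)
  embed-Bgr = contract-map φ reduced braidEdge commEdge

module _ {n} {f : Fin n → Fin n} where

  CommEdge-sym : ∀ {w w'} → CommEdge f w w' → CommEdge f w' w
  CommEdge-sym (rw , rw' , m) = rw' , rw , comm-sym m

  BraidEdge-sym : ∀ {w w'} → BraidEdge f w w' → BraidEdge f w' w
  BraidEdge-sym (rw , rw' , m) = rw' , rw , braid-sym m

  commChain-Gr : ∀ {k x y} → Chain (CommEdge f) k x y → Walk (Gr f) k x y
  commChain-Gr []      = here refl
  commChain-Gr (e ∷ p) = step (inj₁ e) (commChain-Gr p)

  commChain-Bgr : ∀ {k x y} → Chain (CommEdge f) k x y → Walk (Bgr f) k x y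
  commChain-Bgr []                   = here ε
  commChain-Bgr (e@(rx , rz , _) ∷ p) = step (_ , _ , ε , ε , rx , rz , e) (commChain-Bgr p)

  commChain-Cgr : ∀ {k x y} → Chain (CommEdge f) k x y → Same (Cgr f) x y
  commChain-Cgr []                   = ε
  commChain-Cgr (e@(rx , rz , _) ∷ p) = (rx , rz , e) ◅ commChain-Cgr p

GraphFamily : Set₁
GraphFamily = ∀ {n} → (Fin n → Fin n) → SGraph Word

record WalkOps (K : GraphFamily) : Set₁ where
  field
    vertex    : ∀ {n} {f : Fin n → Fin n} {w} → Reduced f w → V (K f) w
    reduced   : ∀ {n} {f : Fin n → Fin n} {w} → V (K f) w → Reduced f w
    concat    : ∀ {n} {f : Fin n → Fin n} {k m x y z} → Walk (K f) k x y → Walk (K f) m y z → Walk (K f) (k + m) x z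
    commChain : ∀ {n} {f : Fin n → Fin n} {k x y} → Chain (CommEdge f) k x y → Walk (K f) k x y
    embed     : ∀ {m n} {f : Fin m → Fin m} {g : Fin n → Fin n} {φ} → IsEmbedding f g φ
              → ∀ {k x y} → Walk (K f) k x y → Walk (K g) k (φ x) (φ y)

Gr-ops : WalkOps Gr
Gr-ops = record
  { vertex = λ r → r ; reduced = λ r → r ; concat = plain-++ ; commChain = commChain-Gr ; embed = IsEmbedding.embed-Gr }

Bgr-ops : WalkOps Bgr
Bgr-ops = record
  { vertex = λ r → r ; reduced = λ r → r ; concat = contract-++ ; commChain = commChain-Bgr ; embed = IsEmbedding.embed-Bgr }

-- Diameters

start-≡ : ∀ {A} {G : SGraph A} {k x x' y} → x ≡ x' → Walk G k x' y → Walk G k x y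
start-≡ refl W = W

-- A walk of length k, ending with potential P' and starting with potential P, pays for kα + kβ projected steps.
record Amortised (kα kβ k P' P : ℕ) : Set where
  constructor amortised
  field
    bound : kα + kβ + P' ≤ k + P

charge : ∀ i j {kα kβ k P' Pz Pw} → Amortised kα kβ k P' Pz → i + j + Pz ≤ suc Pw
  → Amortised (i + kα) (j + kβ) (suc k) P' Pw
charge i j {kα} {kβ} {k} {P'} {Pz} {Pw} (amortised rest) moved = amortised (begin
  i + kα + (j + kβ) + P'     ≡⟨ solve 5 (λ i j kα kβ P' → i :+ kα :+ (j :+ kβ) :+ P' := i :+ j :+ (kα :+ kβ :+ P'))
                                        refl i j kα kβ P' ⟩
  i + j + (kα + kβ + P')     ≤⟨ +-monoʳ-≤ (i + j) rest ⟩
  i + j + (k + Pz)           ≡⟨ solve 4 (λ i j k Pz → i :+ j :+ (k :+ Pz) := k :+ (i :+ j :+ Pz)) refl i j k Pz ⟩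
  k + (i + j + Pz)           ≤⟨ +-monoʳ-≤ k moved ⟩
  k + suc Pw                 ≡⟨ +-suc k Pw ⟩
  suc k + Pw                 ∎)
  where
  open ≤-Reasoning
  open +-*-Solver

±1⇒≤suc : ∀ {P Q} → P ≡ suc Q ⊎ Q ≡ suc P → Q ≤ suc P
±1⇒≤suc (inj₁ refl) = ≤-trans (n≤1+n _) (n≤1+n _)
±1⇒≤suc (inj₂ refl) = ≤-refl

complementary-≤ : ∀ {p₁ q₁ p₂ q₂ N} → p₁ + q₁ ≡ N → p₂ + q₂ ≡ N → p₁ + p₂ ≤ N ⊎ q₁ + q₂ ≤ N
complementary-≤ {p₁} {q₁} {p₂} {q₂} {N} e₁ e₂ with p₁ + p₂ ≤? N
... | yes p≤N = inj₁ p≤N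
... | no p≰N  = inj₂ (<⇒≤ (+-cancelʳ-< N (q₁ + q₂) N (begin-strict
  q₁ + q₂ + N         <⟨ +-monoʳ-< (q₁ + q₂) (≰⇒> p≰N) ⟩
  q₁ + q₂ + (p₁ + p₂) ≡⟨ solve 4 (λ p₁ q₁ p₂ q₂ → q₁ :+ q₂ :+ (p₁ :+ p₂) := p₁ :+ q₁ :+ (p₂ :+ q₂))
                                 refl p₁ q₁ p₂ q₂ ⟩
  p₁ + q₁ + (p₂ + q₂) ≡⟨ cong₂ _+_ e₁ e₂ ⟩
  N + N               ∎)))
  where
  open ≤-Reasoning
  open +-*-Solver

route-≤ : ∀ {kα kβ dα dβ s t N} → kα ≤ dα → kβ ≤ dβ → s + t ≤ N → s + (kα + (kβ + t)) ≤ dα + dβ + N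
route-≤ {kα} {kβ} {dα} {dβ} {s} {t} {N} kα≤ kβ≤ s+t≤ = begin
  s + (kα + (kβ + t))   ≡⟨ solve 4 (λ s kα kβ t → s :+ (kα :+ (kβ :+ t)) := kα :+ kβ :+ (s :+ t)) refl s kα kβ t ⟩
  kα + kβ + (s + t)     ≤⟨ +-mono-≤ (+-mono-≤ kα≤ kβ≤) s+t≤ ⟩
  dα + dβ + N           ∎
  where
  open ≤-Reasoning
  open +-*-Solver

module InflatedWalks {a b : ℕ} (α : Fin a → Fin a) (β : Fin b → Fin b) (len-π≡ : len (inflate α β) ≡ len α + len β) where
  open Inflation α β
  open Split a

  module _ {w} (r : Reduced π w) where
    avoids : All (_≢ a) w
    avoids = proj₁ (reduced-projections len-π≡ r)
    low-reduced : Reduced α (low a w)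
    low-reduced = proj₁ (proj₂ (reduced-projections len-π≡ r))
    high-reduced : Reduced β (high a w)
    high-reduced = proj₂ (proj₂ (reduced-projections len-π≡ r))

  N : ℕ
  N = len α * len β

  on-low : ∀ (M : Word → Word → Set) {w z} → Reduced π w → Reduced π z → M (low a w) (low a z)
         → Reduced α (low a w) × Reduced α (low a z) × M (low a w) (low a z)
  on-low _ r₁ r₂ m = low-reduced r₁ , low-reduced r₂ , m

  on-high : ∀ (M : Word → Word → Set) {w z} → Reduced π w → Reduced π z → M (high a w) (high a z)
          → Reduced β (high a w) × Reduced β (high a z) × M (high a w) (high a z)
  on-high _ r₁ r₂ m = high-reduced r₁ , high-reduced r₂ , m

  highLow+lowHigh≡N : ∀ {w} → Reduced π w → highLow w + disorder isLow w ≡ N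
  highLow+lowHigh≡N {w} r = trans (highLow+lowHigh w (avoids r))
    (trans (cong₂ _*_ (proj₁ (proj₂ (high-reduced r))) (proj₁ (proj₂ (low-reduced r)))) (*-comm (len β) (len α)))

  module _ {x y} (rx : Reduced α x) (ry : Reduced β y) where
    private
      x<a : All (_< a) x
      x<a = All.map proj₂ (proj₁ rx)
      a<shift-y : All (a <_) (shift a y)
      a<shift-y = map⁺ (All.map (λ {r} 1≤r → subst (_< a + r) (+-identityʳ a) (+-monoʳ-< a 1≤r))
                                (All.map proj₁ (proj₁ ry)))

    highLow-x++y : highLow (x ++ shift a y) ≡ 0
    highLow-x++y = highLow-sorted x<a a<shift-y

    highLow-y++x : highLow (shift a y ++ x) ≡ N
    highLow-y++x = trans (highLow-reversed x<a a<shift-y)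
      (trans (cong₂ _*_ (trans (length-map (a +_) y) (proj₁ (proj₂ ry))) (proj₁ (proj₂ rx))) (*-comm (len β) (len α)))

  record Layout : Set where
    field
      glue     : Word → Word → Word
      order    : ℕ → Bool
      sorted≡  : ∀ {w} → Reduced π w → sorted order w ≡ glue (low a w) (high a w)
      farApart : ∀ {u j k v} → Reduced π (u ++ j ∷ k ∷ v) → order j ≡ true → order k ≡ false → FarApart j k
      alongα   : ∀ {y} → Reduced β y → IsEmbedding α π (λ x → glue x y)
      alongβ   : ∀ {x} → Reduced α x → IsEmbedding β π (glue x)

    toGlued : ∀ {w} → Reduced π w → Chain (CommEdge π) (disorder order w) w (glue (low a w) (high a w))
    toGlued r = subst (Chain _ _ _) (sorted≡ r) (sortingChain order swap r)
      where
      swap : ∀ {u j k v} → Reduced π (u ++ j ∷ k ∷ v) → order j ≡ true → order k ≡ false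
           → CommEdge π (u ++ j ∷ k ∷ v) (u ++ k ∷ j ∷ v) × Reduced π (u ++ k ∷ j ∷ v)
      swap {u} {j} {k} {v} r oj ok = (r , r' , move) , r'
        where
        move = u , v , j , k , farApart r oj ok , refl , refl
        r'   = comm-preserves-Reduced π r move

  second-letter-avoids : ∀ {u j k v} → Reduced π (u ++ j ∷ k ∷ v) → k ≢ a
  second-letter-avoids {u} r with ++⁻ʳ u (avoids r)
  ... | _ ∷ k≢a ∷ _ = k≢a

  low-first : Layout
  low-first = record
    { glue     = λ x y → x ++ shift a y
    ; order    = isHigh
    ; sorted≡  = λ r → sorted-isHigh _ (avoids r)
    ; farApart = λ r hj lk → inj₂ (≤-<-trans (≤∧≢⇒< (<ᵇ-false⇒≥ lk) (second-letter-avoids r)) (<ᵇ-true⇒< hj))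
    ; alongα   = λ ry → record { comm = comm-++ʳ _ ; braid = braid-++ʳ _ ; reduced = λ rx → reduced-x++y len-π≡ rx ry }
    ; alongβ   = λ {x} rx → record { comm = comm-++ˡ x ∘ comm-shift a ; braid = braid-++ˡ x ∘ braid-shift a
                                   ; reduced = reduced-x++y len-π≡ rx }
    }

  high-first : Layout
  high-first = record
    { glue     = λ x y → shift a y ++ x
    ; order    = isLow
    ; sorted≡  = λ r → sorted-isLow _ (avoids r)
    ; farApart = λ r lj hk →
        inj₁ (≤-<-trans (<ᵇ-true⇒< lj) (≤∧≢⇒< (<ᵇ-false⇒≥ hk) (≢-sym (second-letter-avoids r))))
    ; alongα   = λ {y} ry → record { comm = comm-++ˡ (shift a y) ; braid = braid-++ˡ (shift a y)
                                   ; reduced = λ rx → reduced-y++x len-π≡ rx ry }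
    ; alongβ   = λ {x} rx → record { comm = comm-++ʳ x ∘ comm-shift a ; braid = braid-++ʳ x ∘ braid-shift a
                                   ; reduced = reduced-y++x len-π≡ rx }
    }

  -- Sort w₁ by commutations, walk in the two blocks, unsort into w₂.
  route : ∀ {K : GraphFamily} → WalkOps K → (L : Layout) → ∀ {w₁ w₂ kα kβ} → Reduced π w₁ → Reduced π w₂
    → Walk (K α) kα (low a w₁) (low a w₂) → Walk (K β) kβ (high a w₁) (high a w₂)
    → Walk (K π) (disorder (Layout.order L) w₁ + (kα + (kβ + disorder (Layout.order L) w₂))) w₁ w₂
  route ops L r₁ r₂ Wα Wβ =
    concat (commChain (toGlued r₁)) (concat (embed (alongα (high-reduced r₁)) Wα)
      (concat (embed (alongβ (low-reduced r₂)) Wβ) (commChain (Chain-reverse CommEdge-sym (toGlued r₂)))))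
    where
    open WalkOps ops
    open Layout L

  ProjectsWalks : GraphFamily → Set
  ProjectsWalks K = ∀ {k w w'} → Walk (K π) k w w'
    → ∃[ kα ] ∃[ kβ ] (Walk (K α) kα (low a w) (low a w') × Walk (K β) kβ (high a w) (high a w')
                       × Amortised kα kβ k (highLow w') (highLow w))

  project-Gr : ProjectsWalks Gr
  project-Gr (here refl) = 0 , 0 , here refl , here refl , amortised ≤-refl
  project-Gr (step (inj₁ (r₁ , r₂ , m)) p) with project-Gr p | commKind (avoids r₁) m
  ... | kα , kβ , Wα , Wβ , paid | low-comm mα high≡ hl≡ =
    suc kα , kβ , step (inj₁ (on-low CommMove r₁ r₂ mα)) Wα , start-≡ high≡ Wβ ,
    charge 1 0 paid (≤-reflexive (cong suc (sym hl≡)))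
  ... | kα , kβ , Wα , Wβ , paid | high-comm low≡ mβ hl≡ =
    kα , suc kβ , start-≡ low≡ Wα , step (inj₁ (on-high CommMove r₁ r₂ mβ)) Wβ ,
    charge 0 1 paid (≤-reflexive (cong suc (sym hl≡)))
  ... | kα , kβ , Wα , Wβ , paid | cross-comm low≡ high≡ hl±1 =
    kα , kβ , start-≡ low≡ Wα , start-≡ high≡ Wβ , charge 0 0 paid (±1⇒≤suc hl±1)
  project-Gr (step (inj₂ (r₁ , r₂ , m)) p) with project-Gr p | braidKind (avoids r₁) m
  ... | kα , kβ , Wα , Wβ , paid | low-braid mα high≡ hl≡ =
    suc kα , kβ , step (inj₂ (on-low BraidMove r₁ r₂ mα)) Wα , start-≡ high≡ Wβ ,
    charge 1 0 paid (≤-reflexive (cong suc (sym hl≡)))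
  ... | kα , kβ , Wα , Wβ , paid | high-braid low≡ mβ hl≡ =
    kα , suc kβ , start-≡ low≡ Wα , step (inj₂ (on-high BraidMove r₁ r₂ mβ)) Wβ ,
    charge 0 1 paid (≤-reflexive (cong suc (sym hl≡)))

  same-Cgr : ∀ {w w'} → Same (Cgr π) w w' → Same (Cgr α) (low a w) (low a w') × Same (Cgr β) (high a w) (high a w')
  same-Cgr ε = ε , ε
  same-Cgr ((r₁ , r₂ , (_ , _ , m)) ◅ s) with same-Cgr s | commKind (avoids r₁) m
  ... | sα , sβ | low-comm mα high≡ _ =
    (low-reduced r₁ , low-reduced r₂ , on-low CommMove r₁ r₂ mα) ◅ sα , ≡-Same (Cgr β) high≡ sβ
  ... | sα , sβ | high-comm low≡ mβ _ =
    ≡-Same (Cgr α) low≡ sα , (high-reduced r₁ , high-reduced r₂ , on-high CommMove r₁ r₂ mβ) ◅ sβ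
  ... | sα , sβ | cross-comm low≡ high≡ _ =
    ≡-Same (Cgr α) low≡ sα , ≡-Same (Cgr β) high≡ sβ

  same-Bgr : ∀ {w w'} → Same (Bgr π) w w'
    → Same (Bgr α) (low a w) (low a w') × Same (Bgr β) (high a w) (high a w') × highLow w ≡ highLow w'
  same-Bgr ε = ε , ε , refl
  same-Bgr ((r₁ , r₂ , (_ , _ , m)) ◅ s) with same-Bgr s | braidKind (avoids r₁) m
  ... | sα , sβ , hl≡ | low-braid mα high≡ hl≡' =
    (low-reduced r₁ , low-reduced r₂ , on-low BraidMove r₁ r₂ mα) ◅ sα , ≡-Same (Bgr β) high≡ sβ , trans hl≡' hl≡
  ... | sα , sβ , hl≡ | high-braid low≡ mβ hl≡' =
    ≡-Same (Bgr α) low≡ sα , (high-reduced r₁ , high-reduced r₂ , on-high BraidMove r₁ r₂ mβ) ◅ sβ , trans hl≡' hl≡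

  -- An edge of a contracted graph joins w to z through class representatives w₁ ~ w and z₁ ~ z;
  -- on the side where the edge projects to nothing, w and z land in one class.
  project-Cgr : ∀ {k w w'} → Walk (Cgr π) k w w'
    → ∃[ kα ] ∃[ kβ ] (Walk (Cgr α) kα (low a w) (low a w') × Walk (Cgr β) kβ (high a w) (high a w') × kα + kβ ≤ k)
  project-Cgr (here s) = 0 , 0 , here (proj₁ (same-Cgr s)) , here (proj₂ (same-Cgr s)) , z≤n
  project-Cgr {suc k} (step {z = z} (w₁ , z₁ , s₁ , s₂ , v₁ , v₂ , (r₁ , r₂ , m)) p)
    with project-Cgr p | braidKind (avoids r₁) m | same-Cgr s₁ | same-Cgr s₂
  ... | kα , kβ , Wα , Wβ , kα+kβ≤k | low-braid mα high≡ _ | sα₁ , sβ₁ | sα₂ , sβ₂ =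
    suc kα , kβ ,
    step (low a w₁ , low a z₁ , sα₁ , sα₂ , low-reduced v₁ , low-reduced v₂ , on-low BraidMove r₁ r₂ mα) Wα ,
    Same-◅ (sβ₁ ◅◅ ≡-Same (Cgr β) high≡ (Same-sym {E = BraidEdge β} CommEdge-sym sβ₂)) Wβ ,
    s≤s kα+kβ≤k
  ... | kα , kβ , Wα , Wβ , kα+kβ≤k | high-braid low≡ mβ _ | sα₁ , sβ₁ | sα₂ , sβ₂ =
    kα , suc kβ ,
    Same-◅ (sα₁ ◅◅ ≡-Same (Cgr α) low≡ (Same-sym {E = BraidEdge α} CommEdge-sym sα₂)) Wα ,
    step (high a w₁ , high a z₁ , sβ₁ , sβ₂ , high-reduced v₁ , high-reduced v₂ , on-high BraidMove r₁ r₂ mβ) Wβ ,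
    subst (_≤ suc k) (sym (+-suc kα kβ)) (s≤s kα+kβ≤k)

  project-Bgr : ProjectsWalks Bgr
  project-Bgr (here s) = 0 , 0 , here (proj₁ (same-Bgr s)) , here (proj₁ (proj₂ (same-Bgr s))) ,
                         amortised (≤-reflexive (sym (proj₂ (proj₂ (same-Bgr s)))))
  project-Bgr {suc k} {w} (step {z = z} (w₁ , z₁ , s₁ , s₂ , v₁ , v₂ , (r₁ , r₂ , m)) p)
    with project-Bgr p | commKind (avoids r₁) m | same-Bgr s₁ | same-Bgr s₂
  ... | kα , kβ , Wα , Wβ , paid | low-comm mα high≡ hl≡ | sα₁ , sβ₁ , hl₁ | sα₂ , sβ₂ , hl₂ =
    suc kα , kβ ,
    step (low a w₁ , low a z₁ , sα₁ , sα₂ , low-reduced v₁ , low-reduced v₂ , on-low CommMove r₁ r₂ mα) Wα ,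
    Same-◅ (sβ₁ ◅◅ ≡-Same (Bgr β) high≡ (Same-sym {E = CommEdge β} BraidEdge-sym sβ₂)) Wβ ,
    charge 1 0 paid (≤-reflexive (cong suc (sym (trans hl₁ (trans hl≡ (sym hl₂))))))
  ... | kα , kβ , Wα , Wβ , paid | high-comm low≡ mβ hl≡ | sα₁ , sβ₁ , hl₁ | sα₂ , sβ₂ , hl₂ =
    kα , suc kβ ,
    Same-◅ (sα₁ ◅◅ ≡-Same (Bgr α) low≡ (Same-sym {E = CommEdge α} BraidEdge-sym sα₂)) Wα ,
    step (high a w₁ , high a z₁ , sβ₁ , sβ₂ , high-reduced v₁ , high-reduced v₂ , on-high CommMove r₁ r₂ mβ) Wβ ,
    charge 0 1 paid (≤-reflexive (cong suc (sym (trans hl₁ (trans hl≡ (sym hl₂))))))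
  ... | kα , kβ , Wα , Wβ , paid | cross-comm low≡ high≡ hl±1 | sα₁ , sβ₁ , hl₁ | sα₂ , sβ₂ , hl₂ =
    kα , kβ ,
    Same-◅ (sα₁ ◅◅ ≡-Same (Bgr α) low≡ (Same-sym {E = CommEdge α} BraidEdge-sym sα₂)) Wα ,
    Same-◅ (sβ₁ ◅◅ ≡-Same (Bgr β) high≡ (Same-sym {E = CommEdge β} BraidEdge-sym sβ₂)) Wβ ,
    charge 0 0 paid (±1⇒≤suc (subst₂ (λ P Q → P ≡ suc Q ⊎ Q ≡ suc P) (sym hl₁) (sym hl₂) hl±1))

  -- Of the two sortings of w₁ and w₂, one costs at most N commutations in total.
  inflation-diameter : ∀ {K : GraphFamily} → WalkOps K → ProjectsWalks K
    → ∀ {dα dβ} → IsDiam (K α) dα → IsDiam (K β) dβ → IsDiam (K π) (dα + dβ + N)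
  inflation-diameter {K} ops project {dα} {dβ} (connα , x , x' , vx , vx' , farα) (connβ , y , y' , vy , vy' , farβ) =
    connected , x ++ shift a y , shift a y' ++ x' ,
    vertex (reduced-x++y len-π≡ rx ry) , vertex (reduced-y++x len-π≡ rx' ry') , far
    where
    open WalkOps ops using (vertex; reduced)
    rx = reduced vx
    rx' = reduced vx'
    ry = reduced vy
    ry' = reduced vy'
    connected : ∀ w₁ w₂ → V (K π) w₁ → V (K π) w₂ → ∃[ k ] (k ≤ dα + dβ + N × Walk (K π) k w₁ w₂)
    connected w₁ w₂ v₁ v₂
      with reduced v₁ | reduced v₂
    ... | r₁ | r₂
      with connα _ _ (vertex (low-reduced r₁)) (vertex (low-reduced r₂))
         | connβ _ _ (vertex (high-reduced r₁)) (vertex (high-reduced r₂))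
    ... | kα , kα≤ , Wα | kβ , kβ≤ , Wβ =
      [ via low-first , via high-first ]′
        (complementary-≤ {highLow w₁} {disorder isLow w₁} {highLow w₂} {disorder isLow w₂}
                         (highLow+lowHigh≡N r₁) (highLow+lowHigh≡N r₂))
      where
      via : ∀ L → disorder (Layout.order L) w₁ + disorder (Layout.order L) w₂ ≤ N
          → ∃[ k ] (k ≤ dα + dβ + N × Walk (K π) k w₁ w₂)
      via L cheap = _ , route-≤ {s = disorder (Layout.order L) w₁} kα≤ kβ≤ cheap , route ops L r₁ r₂ Wα Wβ
    far : ∀ k → Walk (K π) k (x ++ shift a y) (shift a y' ++ x') → dα + dβ + N ≤ k
    far k W with project W
    ... | kα , kβ , Wα , Wβ , amortised paid = begin
      dα + dβ + N                           ≤⟨ +-monoˡ-≤ N (+-mono-≤ dα≤ dβ≤) ⟩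
      kα + kβ + N                           ≡⟨ cong (kα + kβ +_) (highLow-y++x rx' ry') ⟨
      kα + kβ + highLow (shift a y' ++ x')  ≤⟨ paid ⟩
      k + highLow (x ++ shift a y)          ≡⟨ cong (k +_) (highLow-x++y rx ry) ⟩
      k + 0                                 ≡⟨ +-identityʳ k ⟩
      k                                     ∎
      where
      open ≤-Reasoning
      dα≤ = farα kα (start-≡ (sym (low-x++y rx ry)) (subst (Walk (K α) kα _) (low-y++x rx' ry') Wα))
      dβ≤ = farβ kβ (start-≡ (sym (high-x++y rx ry)) (subst (Walk (K β) kβ _) (high-y++x rx' ry') Wβ))

  inflation-diameter-Cgr : ∀ {dα dβ} → IsDiam (Cgr α) dα → IsDiam (Cgr β) dβ → IsDiam (Cgr π) (dα + dβ)
  inflation-diameter-Cgr {dα} {dβ} (connα , x , x' , rx , rx' , farα) (connβ , y , y' , ry , ry' , farβ) =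
    connected , x ++ shift a y , x' ++ shift a y' , reduced-x++y len-π≡ rx ry , reduced-x++y len-π≡ rx' ry' , far
    where
    open Layout low-first
    connected : ∀ w₁ w₂ → Reduced π w₁ → Reduced π w₂ → ∃[ k ] (k ≤ dα + dβ × Walk (Cgr π) k w₁ w₂)
    connected w₁ w₂ r₁ r₂
      with connα _ _ (low-reduced r₁) (low-reduced r₂) | connβ _ _ (high-reduced r₁) (high-reduced r₂)
    ... | kα , kα≤ , Wα | kβ , kβ≤ , Wβ = kα + kβ , +-mono-≤ kα≤ kβ≤ ,
      Same-◅ (commChain-Cgr (toGlued r₁))
        (▻-Same (contract-++ (IsEmbedding.embed-Cgr (alongα (high-reduced r₁)) Wα)
                             (IsEmbedding.embed-Cgr (alongβ (low-reduced r₂)) Wβ))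
                (commChain-Cgr (Chain-reverse CommEdge-sym (toGlued r₂))))
    far : ∀ k → Walk (Cgr π) k (x ++ shift a y) (x' ++ shift a y') → dα + dβ ≤ k
    far k W with project-Cgr W
    ... | kα , kβ , Wα , Wβ , kα+kβ≤k = ≤-trans (+-mono-≤
      (farα kα (start-≡ (sym (low-x++y rx ry)) (subst (Walk (Cgr α) kα _) (low-x++y rx' ry') Wα)))
      (farβ kβ (start-≡ (sym (high-x++y rx ry)) (subst (Walk (Cgr β) kβ _) (high-x++y rx' ry') Wβ)))) kα+kβ≤k

some-vertex : ∀ {A} {G : SGraph A} {d} → IsDiam G d → ∃ (V G)
some-vertex (_ , x , _ , Vx , _) = x , Vx

module _ {a b : ℕ} (α : Fin a → Fin a) (β : Fin b → Fin b) {dα dβ : ℕ} where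

  diameter-Gr : IsDiam (Gr α) dα → IsDiam (Gr β) dβ → IsDiam (Gr (inflate α β)) (dα + dβ + len α * len β)
  diameter-Gr Dα Dβ = inflation-diameter Gr-ops project-Gr Dα Dβ
    where open InflatedWalks α β (Inflation.len-π α β (proj₂ (some-vertex Dα)) (proj₂ (some-vertex Dβ)))

  diameter-Cgr : IsDiam (Cgr α) dα → IsDiam (Cgr β) dβ → IsDiam (Cgr (inflate α β)) (dα + dβ)
  diameter-Cgr Dα Dβ = inflation-diameter-Cgr Dα Dβ
    where open InflatedWalks α β (Inflation.len-π α β (proj₂ (some-vertex Dα)) (proj₂ (some-vertex Dβ)))

  diameter-Bgr : IsDiam (Bgr α) dα → IsDiam (Bgr β) dβ → IsDiam (Bgr (inflate α β)) (dα + dβ + len α * len β)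
  diameter-Bgr Dα Dβ = inflation-diameter Bgr-ops project-Bgr Dα Dβ
    where open InflatedWalks α β (Inflation.len-π α β (proj₂ (some-vertex Dα)) (proj₂ (some-vertex Dβ)))

theorem3p6 : ∀ {a b} (α : Permutation′ a) (β : Permutation′ b)
    → (∀ dα dβ → IsDiam (Gr (α ⟨$⟩ʳ_)) dα → IsDiam (Gr (β ⟨$⟩ʳ_)) dβ
         → IsDiam (Gr (inflate (α ⟨$⟩ʳ_) (β ⟨$⟩ʳ_)))
                  (dα + dβ + len (α ⟨$⟩ʳ_) * len (β ⟨$⟩ʳ_)))
      × (∀ dα dβ → IsDiam (Cgr (α ⟨$⟩ʳ_)) dα → IsDiam (Cgr (β ⟨$⟩ʳ_)) dβ
         → IsDiam (Cgr (inflate (α ⟨$⟩ʳ_) (β ⟨$⟩ʳ_))) (dα + dβ))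
      × (∀ dα dβ → IsDiam (Bgr (α ⟨$⟩ʳ_)) dα → IsDiam (Bgr (β ⟨$⟩ʳ_)) dβ
         → IsDiam (Bgr (inflate (α ⟨$⟩ʳ_) (β ⟨$⟩ʳ_)))
                  (dα + dβ + len (α ⟨$⟩ʳ_) * len (β ⟨$⟩ʳ_)))
theorem3p6 α β =
    (λ _ _ → diameter-Gr (α ⟨$⟩ʳ_) (β ⟨$⟩ʳ_))
  , (λ _ _ → diameter-Cgr (α ⟨$⟩ʳ_) (β ⟨$⟩ʳ_))
  , (λ _ _ → diameter-Bgr (α ⟨$⟩ʳ_) (β ⟨$⟩ʳ_))
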